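{- Let $n,m,p,q$ be fixed integers with $0\le p\le 2n-4$, $0\le q\le 2n-3$, $p+q\le 2n-3$. Then there is a polynomial $\alpha$ of degree at most $2(2n-3-p-q)+q-1$ such that for all integers $j$ with $1\le j\le n-1$, the coefficient of $x^pz^q$ in $$(2x+m+z+1)_{j-1}\,(x+2z-j+2)_{j-1}\,(x+m+2j-z+2)_{2n-2j-2}\,(m+3j-3z)$$ equals $2^j\alpha(j)$.
   Context: $(u)_k=u(u+1)\cdots(u+k-1)$ for $k\ge1$, $(u)_0=1$; the expression is a polynomial in $x$ and $z$. A polynomial of degree at most $-1$ means the zero polynomial. -}

module Defs where

open import Data.Nat as ℕ using (ℕ; zero; suc)
open import Data.Integer as ℤ using (ℤ; +_)
open import Data.Rational as ℚ using (ℚ)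
open import Data.List using (List; []; _∷_; map)

-- Univariate polynomials in z over ℤ: coefficient lists, ascending powers.
P1 : Set
P1 = List ℤ

add1 : P1 → P1 → P1
add1 [] q = q
add1 p [] = p
add1 (a ∷ p) (b ∷ q) = (a ℤ.+ b) ∷ add1 p q

mul1 : P1 → P1 → P1
mul1 [] q = []
mul1 (a ∷ p) q = add1 (map (a ℤ.*_) q) (+ 0 ∷ mul1 p q)

coeff1 : P1 → ℕ → ℤ
coeff1 [] _ = + 0
coeff1 (a ∷ p) zero = a
coeff1 (a ∷ p) (suc k) = coeff1 p k

-- Bivariate polynomials in x, z over ℤ: lists (ascending powers of x)
-- of polynomials in z.
P2 : Set
P2 = List P1

add2 : P2 → P2 → P2
add2 [] q = q
add2 p [] = p
add2 (a ∷ p) (b ∷ q) = add1 a b ∷ add2 p q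

mul2 : P2 → P2 → P2
mul2 [] q = []
mul2 (a ∷ p) q = add2 (map (mul1 a) q) ([] ∷ mul2 p q)

coeff2 : P2 → ℕ → ℕ → ℤ
coeff2 [] _ _ = + 0
coeff2 (a ∷ P) zero q = coeff1 a q
coeff2 (a ∷ P) (suc p) q = coeff2 P p q

lin : ℤ → ℤ → ℤ → P2
lin a b c = (c ∷ b ∷ []) ∷ (a ∷ []) ∷ []

-- rising factorial (u)_k of u = a x + b z + c : u (u+1) ... (u+k-1), (u)_0 = 1
rise : ℤ → ℤ → ℤ → ℕ → P2
rise a b c zero = (+ 1 ∷ []) ∷ []
rise a b c (suc k) = mul2 (rise a b c k) (lin a b (c ℤ.+ + k))

-- (2x+m+z+1)_{j-1} (x+2z-j+2)_{j-1} (x+m+2j-z+2)_{2n-2j-2} (m+3j-3z)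
expr : ℕ → ℤ → ℕ → P2
expr n m j =
  mul2 (rise (+ 2) (+ 1) (m ℤ.+ + 1) (j ℕ.∸ 1))
  (mul2 (rise (+ 1) (+ 2) (ℤ.- (+ j) ℤ.+ + 2) (j ℕ.∸ 1))
  (mul2 (rise (+ 1) (ℤ.- (+ 1)) (m ℤ.+ + (2 ℕ.* j) ℤ.+ + 2) (2 ℕ.* n ℕ.∸ 2 ℕ.* j ℕ.∸ 2))
        (lin (+ 0) (ℤ.- (+ 3)) (m ℤ.+ + (3 ℕ.* j)))))

evalℚ : List ℚ → ℚ → ℚ
evalℚ [] _ = ℚ.0ℚ
evalℚ (a ∷ p) t = a ℚ.+ t ℚ.* evalℚ p t

-- Write the expression as a product of linear forms a x + b z + c of total degree K = 2n - 3.
-- The coefficient of x^p z^q in such a product is that of x^t z^q, t = K - p - q, in the product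
-- of the swapped forms c x + b z + a (the reciprocal polynomial).  After the swap, the first
-- rising factorial has constant terms 2, which gives the factor 2^(j-1); the other two have
-- constant terms 1 and, with their factors taken in reverse order, x-coefficients starting at 0
-- and at m + 2n - 1.  So, up to 2^(j-1), each is a product of k factors 1 + (c + σ i) x + b z
-- with c, σ, b independent of j.  In such a product the coefficient of x^t z^s is a polynomial
-- in k of degree at most 2t + s, by induction on (t, s): telescoping over the factors, it is
-- 1 or 0 plus the sum over i < k of (c + σ i) times the coefficient of x^(t-1) z^s and b times
-- that of x^t z^(s-1) in the product of the first i factors.  Substituting k = j - 1, j - 1 and
-- 2n - 2 - 2j and multiplying by (m + 3j) x - 3z, the swap of the last factor, yields a
-- polynomial in j of degree at most 2t + q - 1.

module Submission where

open import Data.Nat as ℕ using (ℕ; zero; suc; z≤n; s≤s)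
import Data.Nat.Properties as ℕP
import Data.Nat.Tactic.RingSolver as ℕ-Solver
open import Data.Integer as ℤ using (ℤ; +_)
import Data.Integer.Properties as ℤP
import Data.Integer.Tactic.RingSolver as ℤ-Solver
open import Data.Rational as ℚ using (ℚ; 0ℚ; 1ℚ; _+_; _*_; -_; _-_)
import Data.Rational.Properties as ℚP
import Data.Rational.Unnormalised as ℚᵘ
import Data.Rational.Unnormalised.Properties as ℚᵘP
open import Data.List using (List; []; _∷_; map; length)
import Data.List.Properties as ListP
open import Data.Product using (∃; Σ-syntax; _×_; _,_; proj₁; proj₂)
open import Function using (_∘_)
open import Relation.Binary.Bundles using (Setoid)
import Relation.Binary.Reasoning.Setoid as SetoidReasoning
open import Relation.Binary.PropositionalEquality
open import Relation.Nullary.Decidable using (dec⇒maybe)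
open import Tactic.RingSolver using (solve-∀)
open import Tactic.RingSolver.Core.AlmostCommutativeRing using (AlmostCommutativeRing; fromCommutativeRing)

open import Defs

ℚ-ring : AlmostCommutativeRing _ _
ℚ-ring = fromCommutativeRing ℚP.+-*-commutativeRing (λ x → dec⇒maybe (0ℚ ℚP.≟ x))

combination-of-zeros : ∀ a b c → a * 0ℚ + b * 0ℚ + c * 0ℚ ≡ 0ℚ
combination-of-zeros = solve-∀ ℚ-ring

fromℤ : ℤ → ℚ
fromℤ a = a ℚ./ 1

fromℕ : ℕ → ℚ
fromℕ k = fromℤ (+ k)

private
  toℚᵘ-fromℤ : ∀ a → ℚ.toℚᵘ (fromℤ a) ℚᵘ.≃ ℚᵘ.mkℚᵘ a 0
  toℚᵘ-fromℤ a = ℚP.toℚᵘ-fromℚᵘ (ℚᵘ.mkℚᵘ a 0)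

fromℤ-+ : ∀ a b → fromℤ (a ℤ.+ b) ≡ fromℤ a + fromℤ b
fromℤ-+ a b = ℚP.toℚᵘ-injective (begin
  ℚ.toℚᵘ (fromℤ (a ℤ.+ b))                       ≈⟨ toℚᵘ-fromℤ (a ℤ.+ b) ⟩
  ℚᵘ.mkℚᵘ (a ℤ.+ b) 0                             ≈⟨ ℚᵘ.*≡* (cross-multiplied a b) ⟩
  ℚᵘ.mkℚᵘ a 0 ℚᵘ.+ ℚᵘ.mkℚᵘ b 0                    ≈⟨ ℚᵘP.+-cong (toℚᵘ-fromℤ a) (toℚᵘ-fromℤ b) ⟨
  ℚ.toℚᵘ (fromℤ a) ℚᵘ.+ ℚ.toℚᵘ (fromℤ b)          ≈⟨ ℚP.toℚᵘ-homo-+ (fromℤ a) (fromℤ b) ⟨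
  ℚ.toℚᵘ (fromℤ a + fromℤ b)                      ∎)
  where
  open SetoidReasoning ℚᵘP.≃-setoid
  cross-multiplied : ∀ a b → (a ℤ.+ b) ℤ.* (+ 1 ℤ.* + 1) ≡ (a ℤ.* + 1 ℤ.+ b ℤ.* + 1) ℤ.* + 1
  cross-multiplied = ℤ-Solver.solve-∀

fromℤ-* : ∀ a b → fromℤ (a ℤ.* b) ≡ fromℤ a * fromℤ b
fromℤ-* a b = ℚP.toℚᵘ-injective (begin
  ℚ.toℚᵘ (fromℤ (a ℤ.* b))                       ≈⟨ toℚᵘ-fromℤ (a ℤ.* b) ⟩
  ℚᵘ.mkℚᵘ (a ℤ.* b) 0                             ≈⟨ ℚᵘ.*≡* (cross-multiplied a b) ⟩
  ℚᵘ.mkℚᵘ a 0 ℚᵘ.* ℚᵘ.mkℚᵘ b 0                    ≈⟨ ℚᵘP.*-cong (toℚᵘ-fromℤ a) (toℚᵘ-fromℤ b) ⟨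
  ℚ.toℚᵘ (fromℤ a) ℚᵘ.* ℚ.toℚᵘ (fromℤ b)          ≈⟨ ℚP.toℚᵘ-homo-* (fromℤ a) (fromℤ b) ⟨
  ℚ.toℚᵘ (fromℤ a * fromℤ b)                      ∎)
  where
  open SetoidReasoning ℚᵘP.≃-setoid
  cross-multiplied : ∀ a b → (a ℤ.* b) ℤ.* (+ 1 ℤ.* + 1) ≡ (a ℤ.* b) ℤ.* + 1
  cross-multiplied = ℤ-Solver.solve-∀

fromℤ-neg : ∀ a → fromℤ (ℤ.- a) ≡ - fromℤ a
fromℤ-neg a = begin
  fromℤ (ℤ.- a)                          ≡⟨ shift (fromℤ (ℤ.- a)) (fromℤ a) ⟩
  fromℤ (ℤ.- a) + fromℤ a - fromℤ a      ≡⟨ cong (_- fromℤ a) (fromℤ-+ (ℤ.- a) a) ⟨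
  fromℤ (ℤ.- a ℤ.+ a) - fromℤ a          ≡⟨ cong (λ c → fromℤ c - fromℤ a) (ℤP.+-inverseˡ a) ⟩
  0ℚ - fromℤ a                           ≡⟨ ℚP.+-identityˡ (- fromℤ a) ⟩
  - fromℤ a                              ∎
  where
  open ≡-Reasoning
  shift : ∀ x y → x ≡ x + y - y
  shift = solve-∀ ℚ-ring

fromℕ-+ : ∀ a b → fromℕ (a ℕ.+ b) ≡ fromℕ a + fromℕ b
fromℕ-+ a b = fromℤ-+ (+ a) (+ b)

fromℕ-suc : ∀ k → fromℕ (suc k) ≡ 1ℚ + fromℕ k
fromℕ-suc = fromℕ-+ 1

fromℕ-* : ∀ a b → fromℕ (a ℕ.* b) ≡ fromℕ a * fromℕ b
fromℕ-* a b = trans (cong fromℤ (ℤP.pos-* a b)) (fromℤ-* (+ a) (+ b))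

fromℕ-suc-inverse : ∀ k → fromℕ (suc k) * (+ 1 ℚ./ suc k) ≡ 1ℚ
fromℕ-suc-inverse k = ℚP.toℚᵘ-injective (begin
  ℚ.toℚᵘ (fromℕ (suc k) * (+ 1 ℚ./ suc k))                ≈⟨ ℚP.toℚᵘ-homo-* (fromℕ (suc k)) (+ 1 ℚ./ suc k) ⟩
  ℚ.toℚᵘ (fromℕ (suc k)) ℚᵘ.* ℚ.toℚᵘ (+ 1 ℚ./ suc k)      ≈⟨ ℚᵘP.*-cong (toℚᵘ-fromℤ (+ suc k)) (ℚP.toℚᵘ-fromℚᵘ (ℚᵘ.mkℚᵘ (+ 1) k)) ⟩
  ℚᵘ.mkℚᵘ (+ suc k) 0 ℚᵘ.* ℚᵘ.mkℚᵘ (+ 1) k                ≈⟨ ℚᵘ.*≡* (cross-multiplied (+ suc k)) ⟩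
  ℚᵘ.1ℚᵘ                                                  ∎)
  where
  open SetoidReasoning ℚᵘP.≃-setoid
  cross-multiplied : ∀ a → (a ℤ.* + 1) ℤ.* + 1 ≡ + 1 ℤ.* (+ 1 ℤ.* a)
  cross-multiplied = ℤ-Solver.solve-∀

½ : ℚ
½ = + 1 ℚ./ 2

double-half : ∀ y → fromℕ 2 * (½ * y) ≡ y
double-half y = trans (sym (ℚP.*-assoc (fromℕ 2) ½ y)) (ℚP.*-identityˡ y)

∑ : ℕ → (ℕ → ℚ) → ℚ
∑ zero    h = 0ℚ
∑ (suc k) h = ∑ k h + h k

syntax ∑ k (λ i → e) = ∑[ i < k ] e

∑-cong : ∀ k {g h : ℕ → ℚ} → (∀ i → i ℕ.< k → g i ≡ h i) → ∑ k g ≡ ∑ k h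
∑-cong zero    eq = refl
∑-cong (suc k) eq = cong₂ _+_ (∑-cong k (λ i i<k → eq i (ℕP.m<n⇒m<1+n i<k))) (eq k (ℕP.n<1+n k))

∑-zero : ∀ k {h : ℕ → ℚ} → (∀ i → h i ≡ 0ℚ) → ∑ k h ≡ 0ℚ
∑-zero zero    eq = refl
∑-zero (suc k) eq = trans (cong₂ _+_ (∑-zero k eq) (eq k)) (ℚP.+-identityˡ 0ℚ)

∑-head : ∀ k (h : ℕ → ℚ) → ∑ (suc k) h ≡ h 0 + ∑ k (h ∘ suc)
∑-head zero    h = ℚP.+-comm 0ℚ (h 0)
∑-head (suc k) h = trans (cong (_+ h (suc k)) (∑-head k h)) (ℚP.+-assoc (h 0) _ _)

∑-reverse : ∀ k (h : ℕ → ℚ) → ∑ k h ≡ ∑[ i < k ] h (k ℕ.∸ suc i)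
∑-reverse zero    h = refl
∑-reverse (suc k) h = begin
  ∑ k h + h k                                ≡⟨ ℚP.+-comm (∑ k h) (h k) ⟩
  h k + ∑ k h                                ≡⟨ cong (λ s → h k + s) (∑-reverse k h) ⟩
  h k + ∑[ i < k ] h (k ℕ.∸ suc i)           ≡⟨ ∑-head k (λ i → h (k ℕ.∸ i)) ⟨
  ∑[ i < suc k ] h (k ℕ.∸ i)                 ∎
  where open ≡-Reasoning

∑-linear₃ : ∀ k (a b c : ℚ) (f g h : ℕ → ℚ) →
  ∑[ i < k ] (a * f i + b * g i + c * h i) ≡ a * ∑ k f + b * ∑ k g + c * ∑ k h
∑-linear₃ zero    a b c f g h = sym (combination-of-zeros a b c)
∑-linear₃ (suc k) a b c f g h =
  trans (cong (_+ (a * f k + b * g k + c * h k)) (∑-linear₃ k a b c f g h))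
        (regroup a b c (∑ k f) (∑ k g) (∑ k h) (f k) (g k) (h k))
  where regroup : ∀ a b c F G H x y z →
                  a * F + b * G + c * H + (a * x + b * y + c * z) ≡ a * (F + x) + b * (G + y) + c * (H + z)
        regroup = solve-∀ ℚ-ring

∑-+ : ∀ k (g h : ℕ → ℚ) → ∑[ i < k ] (g i + h i) ≡ ∑ k g + ∑ k h
∑-+ zero    g h = refl
∑-+ (suc k) g h = trans (cong (_+ (g k + h k)) (∑-+ k g h)) (regroup (∑ k g) (∑ k h) (g k) (h k))
  where regroup : ∀ a b c d → a + b + (c + d) ≡ a + c + (b + d)
        regroup = solve-∀ ℚ-ring

∑-scale : ∀ k (c : ℚ) (h : ℕ → ℚ) → ∑[ i < k ] (c * h i) ≡ c * ∑ k h
∑-scale zero    c h = sym (ℚP.*-zeroʳ c)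
∑-scale (suc k) c h = trans (cong (_+ c * h k) (∑-scale k c h)) (sym (ℚP.*-distribˡ-+ c (∑ k h) (h k)))

∑-telescope : (f g : ℕ → ℚ) → (∀ i → f (suc i) ≡ f i + g i) → ∀ k → f k ≡ f 0 + ∑ k g
∑-telescope f g step zero    = sym (ℚP.+-identityʳ (f 0))
∑-telescope f g step (suc k) = begin
  f (suc k)               ≡⟨ step k ⟩
  f k + g k               ≡⟨ cong (_+ g k) (∑-telescope f g step k) ⟩
  f 0 + ∑ k g + g k       ≡⟨ ℚP.+-assoc (f 0) (∑ k g) (g k) ⟩
  f 0 + ∑ (suc k) g       ∎
  where open ≡-Reasoning

addP : List ℚ → List ℚ → List ℚ
addP []       β        = β
addP α        []       = α
addP (a ∷ α)  (b ∷ β)  = (a + b) ∷ addP α β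

scaleP : ℚ → List ℚ → List ℚ
scaleP c = map (c *_)

mulP : List ℚ → List ℚ → List ℚ
mulP []       β        = []
mulP (a ∷ α)  []       = []
mulP (a ∷ α)  (b ∷ β)  = addP (scaleP a (b ∷ β)) (0ℚ ∷ mulP α (b ∷ β))

composeAffine : List ℚ → ℚ → ℚ → List ℚ
composeAffine []      u v = []
composeAffine (a ∷ α) u v = addP (a ∷ []) (mulP (u ∷ v ∷ []) (composeAffine α u v))

evalℚ-addP : ∀ α β x → evalℚ (addP α β) x ≡ evalℚ α x + evalℚ β x
evalℚ-addP []      β       x = sym (ℚP.+-identityˡ (evalℚ β x))
evalℚ-addP (a ∷ α) []      x = sym (ℚP.+-identityʳ (evalℚ (a ∷ α) x))
evalℚ-addP (a ∷ α) (b ∷ β) x =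
  trans (cong (λ e → a + b + x * e) (evalℚ-addP α β x)) (regroup a b x (evalℚ α x) (evalℚ β x))
  where regroup : ∀ a b x u v → a + b + x * (u + v) ≡ a + x * u + (b + x * v)
        regroup = solve-∀ ℚ-ring

evalℚ-scaleP : ∀ c α x → evalℚ (scaleP c α) x ≡ c * evalℚ α x
evalℚ-scaleP c []      x = sym (ℚP.*-zeroʳ c)
evalℚ-scaleP c (a ∷ α) x =
  trans (cong (λ e → c * a + x * e) (evalℚ-scaleP c α x)) (regroup c a x (evalℚ α x))
  where regroup : ∀ c a x u → c * a + x * (c * u) ≡ c * (a + x * u)
        regroup = solve-∀ ℚ-ring

evalℚ-mulP : ∀ α β x → evalℚ (mulP α β) x ≡ evalℚ α x * evalℚ β x
evalℚ-mulP []      β       x = sym (ℚP.*-zeroˡ (evalℚ β x))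
evalℚ-mulP (a ∷ α) []      x = sym (ℚP.*-zeroʳ (evalℚ (a ∷ α) x))
evalℚ-mulP (a ∷ α) (b ∷ β) x = begin
  evalℚ (addP (scaleP a (b ∷ β)) (0ℚ ∷ mulP α (b ∷ β))) x
    ≡⟨ evalℚ-addP (scaleP a (b ∷ β)) (0ℚ ∷ mulP α (b ∷ β)) x ⟩
  evalℚ (scaleP a (b ∷ β)) x + (0ℚ + x * evalℚ (mulP α (b ∷ β)) x)
    ≡⟨ cong₂ (λ u v → u + (0ℚ + x * v)) (evalℚ-scaleP a (b ∷ β) x) (evalℚ-mulP α (b ∷ β) x) ⟩
  a * evalℚ (b ∷ β) x + (0ℚ + x * (evalℚ α x * evalℚ (b ∷ β) x))
    ≡⟨ regroup a x (evalℚ α x) (evalℚ (b ∷ β) x) ⟩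
  (a + x * evalℚ α x) * evalℚ (b ∷ β) x
    ∎
  where
  open ≡-Reasoning
  regroup : ∀ a x u w → a * w + (0ℚ + x * (u * w)) ≡ (a + x * u) * w
  regroup = solve-∀ ℚ-ring

evalℚ-composeAffine : ∀ α u v x → evalℚ (composeAffine α u v) x ≡ evalℚ α (u + v * x)
evalℚ-composeAffine []      u v x = refl
evalℚ-composeAffine (a ∷ α) u v x = begin
  evalℚ (addP (a ∷ []) (mulP (u ∷ v ∷ []) (composeAffine α u v))) x
    ≡⟨ evalℚ-addP (a ∷ []) (mulP (u ∷ v ∷ []) (composeAffine α u v)) x ⟩
  a + x * 0ℚ + evalℚ (mulP (u ∷ v ∷ []) (composeAffine α u v)) x
    ≡⟨ cong (λ e → a + x * 0ℚ + e) (evalℚ-mulP (u ∷ v ∷ []) (composeAffine α u v) x) ⟩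
  a + x * 0ℚ + (u + x * (v + x * 0ℚ)) * evalℚ (composeAffine α u v) x
    ≡⟨ cong (λ e → a + x * 0ℚ + (u + x * (v + x * 0ℚ)) * e) (evalℚ-composeAffine α u v x) ⟩
  a + x * 0ℚ + (u + x * (v + x * 0ℚ)) * evalℚ α (u + v * x)
    ≡⟨ regroup a u v x (evalℚ α (u + v * x)) ⟩
  a + (u + v * x) * evalℚ α (u + v * x)
    ∎
  where
  open ≡-Reasoning
  regroup : ∀ a u v x e → a + x * 0ℚ + (u + x * (v + x * 0ℚ)) * e ≡ a + (u + v * x) * e
  regroup = solve-∀ ℚ-ring

length-addP : ∀ α β {d} → length α ℕ.≤ d → length β ℕ.≤ d → length (addP α β) ℕ.≤ d
length-addP []      β       lα        lβ        = lβ
length-addP (a ∷ α) []      lα        lβ        = lα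
length-addP (a ∷ α) (b ∷ β) (s≤s lα)  (s≤s lβ)  = s≤s (length-addP α β lα lβ)

length-scaleP : ∀ c α → length (scaleP c α) ≡ length α
length-scaleP c = ListP.length-map (c *_)

length-mulP : ∀ α β → length (mulP α β) ℕ.≤ ℕ.pred (length α ℕ.+ length β)
length-mulP []      β       = z≤n
length-mulP (a ∷ α) []      = z≤n
length-mulP (a ∷ α) (b ∷ β) = length-addP (scaleP a (b ∷ β)) (0ℚ ∷ mulP α (b ∷ β))
  (ℕP.≤-trans (ℕP.≤-reflexive (length-scaleP a (b ∷ β))) (ℕP.m≤n+m (suc (length β)) (length α)))
  (ℕP.≤-trans (s≤s (length-mulP α (b ∷ β)))
    (ℕP.≤-reflexive (trans (cong (suc ∘ ℕ.pred) (ℕP.+-suc (length α) (length β))) (sym (ℕP.+-suc (length α) (length β))))))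

length-composeAffine : ∀ α u v → length (composeAffine α u v) ℕ.≤ length α
length-composeAffine []      u v = z≤n
length-composeAffine (a ∷ α) u v = length-addP (a ∷ []) (mulP (u ∷ v ∷ []) (composeAffine α u v)) (s≤s z≤n)
  (ℕP.≤-trans (length-mulP (u ∷ v ∷ []) (composeAffine α u v)) (s≤s (length-composeAffine α u v)))

IsPoly : ℕ → (ℕ → ℚ) → Set
IsPoly d f = Σ[ α ∈ List ℚ ] length α ℕ.≤ d × (∀ k → f k ≡ evalℚ α (fromℕ k))

IsPoly-ext : ∀ {d} {f g : ℕ → ℚ} → (∀ k → f k ≡ g k) → IsPoly d f → IsPoly d g
IsPoly-ext f≗g (α , len , f≡α) = α , len , λ k → trans (sym (f≗g k)) (f≡α k)

IsPoly-mono : ∀ {d d′} {f : ℕ → ℚ} → d ℕ.≤ d′ → IsPoly d f → IsPoly d′ f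
IsPoly-mono d≤d′ (α , len , f≡α) = α , ℕP.≤-trans len d≤d′ , f≡α

IsPoly-zero : ∀ {d} {f : ℕ → ℚ} → (∀ k → f k ≡ 0ℚ) → IsPoly d f
IsPoly-zero f≡0 = [] , z≤n , f≡0

IsPoly-const : ∀ c → IsPoly 1 (λ _ → c)
IsPoly-const c = c ∷ [] , s≤s z≤n , λ k → sym (constant c (fromℕ k))
  where constant : ∀ c x → c + x * 0ℚ ≡ c
        constant = solve-∀ ℚ-ring

IsPoly-affine : ∀ u v → IsPoly 2 (λ k → u + v * fromℕ k)
IsPoly-affine u v = u ∷ v ∷ [] , s≤s (s≤s z≤n) , λ k → affine u v (fromℕ k)
  where affine : ∀ u v x → u + v * x ≡ u + x * (v + x * 0ℚ)
        affine = solve-∀ ℚ-ring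

IsPoly-+ : ∀ {d} {f g : ℕ → ℚ} → IsPoly d f → IsPoly d g → IsPoly d (λ k → f k + g k)
IsPoly-+ (α , lα , f≡α) (β , lβ , g≡β) =
  addP α β , length-addP α β lα lβ ,
  λ k → trans (cong₂ _+_ (f≡α k) (g≡β k)) (sym (evalℚ-addP α β (fromℕ k)))

IsPoly-scale : ∀ {d} {f : ℕ → ℚ} c → IsPoly d f → IsPoly d (λ k → c * f k)
IsPoly-scale c (α , lα , f≡α) =
  scaleP c α , ℕP.≤-trans (ℕP.≤-reflexive (length-scaleP c α)) lα ,
  λ k → trans (cong (c *_) (f≡α k)) (sym (evalℚ-scaleP c α (fromℕ k)))

IsPoly-* : ∀ {d e} {f g : ℕ → ℚ} → IsPoly (suc d) f → IsPoly e g → IsPoly (d ℕ.+ e) (λ k → f k * g k)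
IsPoly-* (α , lα , f≡α) (β , lβ , g≡β) =
  mulP α β , ℕP.≤-trans (length-mulP α β) (ℕP.pred-mono-≤ (ℕP.+-mono-≤ lα lβ)) ,
  λ k → trans (cong₂ _*_ (f≡α k) (g≡β k)) (sym (evalℚ-mulP α β (fromℕ k)))

IsPoly-∑ : ∀ {d} k (h : ℕ → ℕ → ℚ) → (∀ i → i ℕ.< k → IsPoly d (h i)) → IsPoly d (λ j → ∑[ i < k ] h i j)
IsPoly-∑ zero    h poly = IsPoly-zero (λ _ → refl)
IsPoly-∑ (suc k) h poly =
  IsPoly-+ (IsPoly-∑ k h (λ i i<k → poly i (ℕP.m<n⇒m<1+n i<k))) (poly k (ℕP.n<1+n k))

IsPoly-composeAffine : ∀ α u v → IsPoly (length α) (λ k → evalℚ α (u + v * fromℕ k))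
IsPoly-composeAffine α u v =
  composeAffine α u v , length-composeAffine α u v , λ k → sym (evalℚ-composeAffine α u v (fromℕ k))

-- Prefix sums of polynomials, through the Newton basis of falling factorials

falling : ℕ → ℚ → ℚ
falling zero    x = 1ℚ
falling (suc k) x = falling k x * (x - fromℕ k)

falling-shift : ∀ k x → falling (suc k) (x + 1ℚ) ≡ (x + 1ℚ) * falling k x
falling-shift zero    x = base x
  where base : ∀ x → 1ℚ * (x + 1ℚ - 0ℚ) ≡ (x + 1ℚ) * 1ℚ
        base = solve-∀ ℚ-ring
falling-shift (suc k) x = begin
  falling (suc k) (x + 1ℚ) * (x + 1ℚ - fromℕ (suc k))   ≡⟨ cong₂ (λ u v → u * (x + 1ℚ - v)) (falling-shift k x) (fromℕ-suc k) ⟩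
  (x + 1ℚ) * falling k x * (x + 1ℚ - (1ℚ + fromℕ k))    ≡⟨ regroup x (falling k x) (fromℕ k) ⟩
  (x + 1ℚ) * (falling k x * (x - fromℕ k))              ∎
  where
  open ≡-Reasoning
  regroup : ∀ x f n → (x + 1ℚ) * f * (x + 1ℚ - (1ℚ + n)) ≡ (x + 1ℚ) * (f * (x - n))
  regroup = solve-∀ ℚ-ring

falling-difference : ∀ k x → falling (suc k) (x + 1ℚ) ≡ falling (suc k) x + fromℕ (suc k) * falling k x
falling-difference k x = begin
  falling (suc k) (x + 1ℚ)                                   ≡⟨ falling-shift k x ⟩
  (x + 1ℚ) * falling k x                                     ≡⟨ regroup x (falling k x) (fromℕ k) ⟩
  falling k x * (x - fromℕ k) + (1ℚ + fromℕ k) * falling k x  ≡⟨ cong (λ n → falling (suc k) x + n * falling k x) (fromℕ-suc k) ⟨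
  falling (suc k) x + fromℕ (suc k) * falling k x            ∎
  where
  open ≡-Reasoning
  regroup : ∀ x f n → (x + 1ℚ) * f ≡ f * (x - n) + (1ℚ + n) * f
  regroup = solve-∀ ℚ-ring

falling-at-0 : ∀ k → falling (suc k) 0ℚ ≡ 0ℚ
falling-at-0 zero    = refl
falling-at-0 (suc k) = trans (cong (_* (0ℚ - fromℕ (suc k))) (falling-at-0 k)) (ℚP.*-zeroˡ (0ℚ - fromℕ (suc k)))

∑-falling : ∀ k t → ∑[ i < t ] falling k (fromℕ i) ≡ (+ 1 ℚ./ suc k) * falling (suc k) (fromℕ t)
∑-falling k zero    = sym (trans (cong ((+ 1 ℚ./ suc k) *_) (falling-at-0 k)) (ℚP.*-zeroʳ (+ 1 ℚ./ suc k)))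
∑-falling k (suc t) = begin
  ∑[ i < t ] falling k (fromℕ i) + falling k (fromℕ t)
    ≡⟨ cong (_+ falling k (fromℕ t)) (∑-falling k t) ⟩
  c * falling (suc k) (fromℕ t) + falling k (fromℕ t)
    ≡⟨ cong (λ w → c * falling (suc k) (fromℕ t) + w)
            (trans (cong (_* falling k (fromℕ t)) (fromℕ-suc-inverse k)) (ℚP.*-identityˡ _)) ⟨
  c * falling (suc k) (fromℕ t) + fromℕ (suc k) * c * falling k (fromℕ t)
    ≡⟨ regroup c (fromℕ (suc k)) (falling (suc k) (fromℕ t)) (falling k (fromℕ t)) ⟩
  c * (falling (suc k) (fromℕ t) + fromℕ (suc k) * falling k (fromℕ t))
    ≡⟨ cong (c *_) (falling-difference k (fromℕ t)) ⟨
  c * falling (suc k) (fromℕ t + 1ℚ)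
    ≡⟨ cong (λ x → c * falling (suc k) x) (trans (fromℕ-suc t) (ℚP.+-comm 1ℚ (fromℕ t))) ⟨
  c * falling (suc k) (fromℕ (suc t))
    ∎
  where
  open ≡-Reasoning
  c = + 1 ℚ./ suc k
  regroup : ∀ c n a b → c * a + n * c * b ≡ c * (a + n * b)
  regroup = solve-∀ ℚ-ring

IsPoly-falling : ∀ k → IsPoly (suc k) (falling k ∘ fromℕ)
IsPoly-falling zero    = IsPoly-const 1ℚ
IsPoly-falling (suc k) =
  IsPoly-ext (λ t → ℚP.*-comm _ (falling k (fromℕ t)))
    (IsPoly-* (IsPoly-ext (λ t → sym (affine (fromℕ k) (fromℕ t))) (IsPoly-affine (- fromℕ k) 1ℚ)) (IsPoly-falling k))
  where affine : ∀ n x → x - n ≡ - n + 1ℚ * x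
        affine = solve-∀ ℚ-ring

newton : ℕ → List ℚ → ℚ → ℚ
newton k []       x = 0ℚ
newton k (c ∷ cs) x = c * falling k x + newton (suc k) cs x

addHead : ℚ → List ℚ → List ℚ
addHead c []       = c ∷ []
addHead c (d ∷ ds) = (c + d) ∷ ds

-- x · falling k x = falling (suc k) x + k · falling k x
mulX : ℕ → List ℚ → List ℚ
mulX k []       = []
mulX k (c ∷ cs) = (fromℕ k * c) ∷ addHead c (mulX (suc k) cs)

toNewton : List ℚ → List ℚ
toNewton []      = []
toNewton (a ∷ α) = addHead a (mulX 0 (toNewton α))

newton-addHead : ∀ k c ds x → newton k (addHead c ds) x ≡ c * falling k x + newton k ds x
newton-addHead k c []       x = refl
newton-addHead k c (d ∷ ds) x = regroup c d (falling k x) (newton (suc k) ds x)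
  where regroup : ∀ c d f r → (c + d) * f + r ≡ c * f + (d * f + r)
        regroup = solve-∀ ℚ-ring

newton-mulX : ∀ k cs x → newton k (mulX k cs) x ≡ x * newton k cs x
newton-mulX k []       x = sym (ℚP.*-zeroʳ x)
newton-mulX k (c ∷ cs) x = begin
  fromℕ k * c * falling k x + newton (suc k) (addHead c (mulX (suc k) cs)) x
    ≡⟨ cong (λ r → fromℕ k * c * falling k x + r) (newton-addHead (suc k) c (mulX (suc k) cs) x) ⟩
  fromℕ k * c * falling k x + (c * (falling k x * (x - fromℕ k)) + newton (suc k) (mulX (suc k) cs) x)
    ≡⟨ cong (λ r → fromℕ k * c * falling k x + (c * (falling k x * (x - fromℕ k)) + r)) (newton-mulX (suc k) cs x) ⟩
  fromℕ k * c * falling k x + (c * (falling k x * (x - fromℕ k)) + x * newton (suc k) cs x)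
    ≡⟨ regroup (fromℕ k) c (falling k x) x (newton (suc k) cs x) ⟩
  x * (c * falling k x + newton (suc k) cs x)
    ∎
  where
  open ≡-Reasoning
  regroup : ∀ n c f x r → n * c * f + (c * (f * (x - n)) + x * r) ≡ x * (c * f + r)
  regroup = solve-∀ ℚ-ring

newton-toNewton : ∀ α x → newton 0 (toNewton α) x ≡ evalℚ α x
newton-toNewton []      x = refl
newton-toNewton (a ∷ α) x = begin
  newton 0 (addHead a (mulX 0 (toNewton α))) x       ≡⟨ newton-addHead 0 a (mulX 0 (toNewton α)) x ⟩
  a * 1ℚ + newton 0 (mulX 0 (toNewton α)) x          ≡⟨ cong₂ _+_ (ℚP.*-identityʳ a) (newton-mulX 0 (toNewton α) x) ⟩
  a + x * newton 0 (toNewton α) x                    ≡⟨ cong (λ r → a + x * r) (newton-toNewton α x) ⟩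
  a + x * evalℚ α x                                  ∎
  where open ≡-Reasoning

length-addHead : ∀ c ds {d} → length ds ℕ.≤ suc d → length (addHead c ds) ℕ.≤ suc d
length-addHead c []       len = s≤s z≤n
length-addHead c (d ∷ ds) len = len

length-mulX : ∀ k cs → length (mulX k cs) ℕ.≤ suc (length cs)
length-mulX k []       = z≤n
length-mulX k (c ∷ cs) = s≤s (length-addHead c (mulX (suc k) cs) (length-mulX (suc k) cs))

length-toNewton : ∀ α → length (toNewton α) ℕ.≤ length α
length-toNewton []      = z≤n
length-toNewton (a ∷ α) =
  length-addHead a (mulX 0 (toNewton α)) (ℕP.≤-trans (length-mulX 0 (toNewton α)) (s≤s (length-toNewton α)))

IsPoly-∑-newton : ∀ k cs → IsPoly (suc (k ℕ.+ length cs)) (λ t → ∑[ i < t ] newton k cs (fromℕ i))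
IsPoly-∑-newton k []       = IsPoly-zero (λ t → ∑-zero t (λ _ → refl))
IsPoly-∑-newton k (c ∷ cs) =
  IsPoly-ext (λ t → sym (sum-split t))
    (IsPoly-+ (IsPoly-mono (s≤s (ℕP.m<m+n k (s≤s z≤n)))
                 (IsPoly-scale (c * (+ 1 ℚ./ suc k)) (IsPoly-falling (suc k))))
              (IsPoly-mono (ℕP.≤-reflexive (cong suc (sym (ℕP.+-suc k (length cs))))) (IsPoly-∑-newton (suc k) cs)))
  where
  sum-split : ∀ t → ∑[ i < t ] newton k (c ∷ cs) (fromℕ i)
                  ≡ c * (+ 1 ℚ./ suc k) * falling (suc k) (fromℕ t) + ∑[ i < t ] newton (suc k) cs (fromℕ i)
  sum-split t = trans (∑-+ t _ _) (cong (_+ ∑[ i < t ] newton (suc k) cs (fromℕ i))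
                  (trans (∑-scale t c _) (trans (cong (c *_) (∑-falling k t)) (sym (ℚP.*-assoc c _ _)))))

IsPoly-prefixSum : ∀ {d} {g : ℕ → ℚ} → IsPoly d g → IsPoly (suc d) (λ t → ∑ t g)
IsPoly-prefixSum (α , len , g≡α) =
  IsPoly-ext (λ t → ∑-cong t (λ i _ → trans (newton-toNewton α (fromℕ i)) (sym (g≡α i))))
    (IsPoly-mono (s≤s (ℕP.≤-trans (length-toNewton α) len)) (IsPoly-∑-newton 0 (toNewton α)))

-- Coefficient tables of polynomials in x and z

Table : Set
Table = ℕ → ℕ → ℚ

infix 4 _≐_
_≐_ : Table → Table → Set
f ≐ g = ∀ p q → f p q ≡ g p q

≐-setoid : Setoid _ _
≐-setoid = record
  { Carrier       = Table
  ; _≈_           = _≐_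
  ; isEquivalence = record
    { refl  = λ p q → refl
    ; sym   = λ f≐g p q → sym (f≐g p q)
    ; trans = λ f≐g g≐h p q → trans (f≐g p q) (g≐h p q)
    }
  }

open Setoid ≐-setoid public using () renaming (refl to ≐-refl; sym to ≐-sym; trans to ≐-trans)
module ≐-Reasoning = SetoidReasoning ≐-setoid

one : Table
one zero    zero    = 1ℚ
one zero    (suc q) = 0ℚ
one (suc p) q       = 0ℚ

timesX : Table → Table
timesX f zero    q = 0ℚ
timesX f (suc p) q = f p q

timesZ : Table → Table
timesZ f p zero    = 0ℚ
timesZ f p (suc q) = f p q

scaleT : ℚ → Table → Table
scaleT c f p q = c * f p q

mulLin : ℚ → ℚ → ℚ → Table → Table
mulLin a b c f p q = a * timesX f p q + b * timesZ f p q + c * f p q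

mulT : Table → Table → Table
mulT f g p q = ∑[ a < suc p ] (∑[ b < suc q ] (f a b * g (p ℕ.∸ a) (q ℕ.∸ b)))

coeffs : P2 → Table
coeffs A p q = fromℤ (coeff2 A p q)

timesX-cong : ∀ {f g} → f ≐ g → timesX f ≐ timesX g
timesX-cong f≐g zero    q = refl
timesX-cong f≐g (suc p) q = f≐g p q

timesZ-cong : ∀ {f g} → f ≐ g → timesZ f ≐ timesZ g
timesZ-cong f≐g p zero    = refl
timesZ-cong f≐g p (suc q) = f≐g p q

mulLin-cong : ∀ {a b c a′ b′ c′ f g} → a ≡ a′ → b ≡ b′ → c ≡ c′ → f ≐ g → mulLin a b c f ≐ mulLin a′ b′ c′ g
mulLin-cong {a} {b} {c} refl refl refl f≐g p q =
  cong₂ _+_ (cong₂ _+_ (cong (a *_) (timesX-cong f≐g p q)) (cong (b *_) (timesZ-cong f≐g p q))) (cong (c *_) (f≐g p q))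

mulLin-congʳ : ∀ a b c {f g} → f ≐ g → mulLin a b c f ≐ mulLin a b c g
mulLin-congʳ a b c = mulLin-cong {a} {b} {c} refl refl refl

scaleT-cong : ∀ c {f g} → f ≐ g → scaleT c f ≐ scaleT c g
scaleT-cong c f≐g p q = cong (c *_) (f≐g p q)

timesX-mulLin : ∀ a b c f → timesX (mulLin a b c f) ≐ mulLin a b c (timesX f)
timesX-mulLin a b c f zero    zero    = sym (combination-of-zeros a b c)
timesX-mulLin a b c f zero    (suc q) = sym (combination-of-zeros a b c)
timesX-mulLin a b c f (suc p) zero    = refl
timesX-mulLin a b c f (suc p) (suc q) = refl

timesZ-mulLin : ∀ a b c f → timesZ (mulLin a b c f) ≐ mulLin a b c (timesZ f)
timesZ-mulLin a b c f zero    zero    = sym (combination-of-zeros a b c)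
timesZ-mulLin a b c f (suc p) zero    = sym (combination-of-zeros a b c)
timesZ-mulLin a b c f zero    (suc q) = refl
timesZ-mulLin a b c f (suc p) (suc q) = refl

timesX-timesZ : ∀ f → timesX (timesZ f) ≐ timesZ (timesX f)
timesX-timesZ f zero    zero    = refl
timesX-timesZ f zero    (suc q) = refl
timesX-timesZ f (suc p) zero    = refl
timesX-timesZ f (suc p) (suc q) = refl

mulLin-comm : ∀ a b c a′ b′ c′ f → mulLin a b c (mulLin a′ b′ c′ f) ≐ mulLin a′ b′ c′ (mulLin a b c f)
mulLin-comm a b c a′ b′ c′ f p q = begin
  a * timesX (mulLin a′ b′ c′ f) p q + b * timesZ (mulLin a′ b′ c′ f) p q + c * mulLin a′ b′ c′ f p q
    ≡⟨ cong₂ (λ u v → a * u + b * v + c * mulLin a′ b′ c′ f p q)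
             (timesX-mulLin a′ b′ c′ f p q) (timesZ-mulLin a′ b′ c′ f p q) ⟩
  a * mulLin a′ b′ c′ (timesX f) p q + b * mulLin a′ b′ c′ (timesZ f) p q + c * mulLin a′ b′ c′ f p q
    ≡⟨ swap a b c a′ b′ c′ (timesX (timesX f) p q) (timesX (timesZ f) p q) (timesZ (timesX f) p q)
            (timesZ (timesZ f) p q) (timesX f p q) (timesZ f p q) (f p q) (timesX-timesZ f p q) ⟩
  a′ * mulLin a b c (timesX f) p q + b′ * mulLin a b c (timesZ f) p q + c′ * mulLin a b c f p q
    ≡⟨ cong₂ (λ u v → a′ * u + b′ * v + c′ * mulLin a b c f p q)
             (timesX-mulLin a b c f p q) (timesZ-mulLin a b c f p q) ⟨
  a′ * timesX (mulLin a b c f) p q + b′ * timesZ (mulLin a b c f) p q + c′ * mulLin a b c f p q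
    ∎
  where
  open ≡-Reasoning
  swap : ∀ a b c a′ b′ c′ xx xz zx zz x z f → xz ≡ zx →
    a * (a′ * xx + b′ * zx + c′ * x) + b * (a′ * xz + b′ * zz + c′ * z) + c * (a′ * x + b′ * z + c′ * f)
    ≡ a′ * (a * xx + b * zx + c * x) + b′ * (a * xz + b * zz + c * z) + c′ * (a * x + b * z + c * f)
  swap a b c a′ b′ c′ xx xz zx zz x z f refl = commute a b c a′ b′ c′ xx xz zz x z f
    where commute : ∀ a b c a′ b′ c′ xx xz zz x z f →
            a * (a′ * xx + b′ * xz + c′ * x) + b * (a′ * xz + b′ * zz + c′ * z) + c * (a′ * x + b′ * z + c′ * f)
            ≡ a′ * (a * xx + b * xz + c * x) + b′ * (a * xz + b * zz + c * z) + c′ * (a * x + b * z + c * f)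
          commute = solve-∀ ℚ-ring

mulT-cong : ∀ {f f′ g g′} → f ≐ f′ → g ≐ g′ → mulT f g ≐ mulT f′ g′
mulT-cong f≐f′ g≐g′ p q =
  ∑-cong (suc p) (λ a _ → ∑-cong (suc q) (λ b _ → cong₂ _*_ (f≐f′ a b) (g≐g′ (p ℕ.∸ a) (q ℕ.∸ b))))

mulT-congˡ : ∀ g {f f′} → f ≐ f′ → mulT f g ≐ mulT f′ g
mulT-congˡ g f≐f′ = mulT-cong f≐f′ (≐-refl {g})

mulT-comm : ∀ f g → mulT f g ≐ mulT g f
mulT-comm f g p q = begin
  ∑[ a < suc p ] (∑[ b < suc q ] (f a b * g (p ℕ.∸ a) (q ℕ.∸ b)))
    ≡⟨ ∑-reverse (suc p) _ ⟩
  ∑[ a < suc p ] (∑[ b < suc q ] (f (p ℕ.∸ a) b * g (p ℕ.∸ (p ℕ.∸ a)) (q ℕ.∸ b)))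
    ≡⟨ ∑-cong (suc p) (λ a _ → ∑-reverse (suc q) _) ⟩
  ∑[ a < suc p ] (∑[ b < suc q ] (f (p ℕ.∸ a) (q ℕ.∸ b) * g (p ℕ.∸ (p ℕ.∸ a)) (q ℕ.∸ (q ℕ.∸ b))))
    ≡⟨ ∑-cong (suc p) (λ a a≤p → ∑-cong (suc q) (λ b b≤q →
         trans (ℚP.*-comm (f (p ℕ.∸ a) (q ℕ.∸ b)) _) (cong₂ (λ a′ b′ → g a′ b′ * f (p ℕ.∸ a) (q ℕ.∸ b))
                                      (ℕP.m∸[m∸n]≡n (ℕP.≤-pred a≤p)) (ℕP.m∸[m∸n]≡n (ℕP.≤-pred b≤q))))) ⟩
  ∑[ a < suc p ] (∑[ b < suc q ] (g a b * f (p ℕ.∸ a) (q ℕ.∸ b)))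
    ∎
  where open ≡-Reasoning

mulT-timesXˡ : ∀ f g → mulT (timesX f) g ≐ timesX (mulT f g)
mulT-timesXˡ f g zero    q = trans (ℚP.+-identityˡ _) (∑-zero (suc q) (λ b → ℚP.*-zeroˡ (g 0 (q ℕ.∸ b))))
mulT-timesXˡ f g (suc p) q =
  trans (∑-head (suc p) _)
        (trans (cong (_+ mulT f g p q) (∑-zero (suc q) (λ b → ℚP.*-zeroˡ (g (suc p) (q ℕ.∸ b)))))
               (ℚP.+-identityˡ (mulT f g p q)))

mulT-timesZˡ : ∀ f g → mulT (timesZ f) g ≐ timesZ (mulT f g)
mulT-timesZˡ f g p zero    =
  ∑-zero (suc p) (λ a → trans (ℚP.+-identityˡ _) (ℚP.*-zeroˡ (g (p ℕ.∸ a) 0)))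
mulT-timesZˡ f g p (suc q) = ∑-cong (suc p) (λ a _ →
  trans (∑-head (suc q) (λ b → timesZ f a b * g (p ℕ.∸ a) (suc q ℕ.∸ b)))
        (trans (cong (_+ ∑[ b < suc q ] (f a b * g (p ℕ.∸ a) (q ℕ.∸ b))) (ℚP.*-zeroˡ (g (p ℕ.∸ a) (suc q)))) (ℚP.+-identityˡ _)))

mulT-mulLinˡ : ∀ a b c f g → mulT (mulLin a b c f) g ≐ mulLin a b c (mulT f g)
mulT-mulLinˡ a b c f g p q = begin
  mulT (mulLin a b c f) g p q
    ≡⟨ ∑-cong (suc p) (λ i _ → trans (∑-cong (suc q) (λ j _ → distribute a b c _ _ _ _)) (∑-linear₃ (suc q) a b c _ _ _)) ⟩
  ∑[ i < suc p ] (a * ∑[ j < suc q ] (timesX f i j * g (p ℕ.∸ i) (q ℕ.∸ j))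
                 + b * ∑[ j < suc q ] (timesZ f i j * g (p ℕ.∸ i) (q ℕ.∸ j))
                 + c * ∑[ j < suc q ] (f i j * g (p ℕ.∸ i) (q ℕ.∸ j)))
    ≡⟨ ∑-linear₃ (suc p) a b c _ _ _ ⟩
  a * mulT (timesX f) g p q + b * mulT (timesZ f) g p q + c * mulT f g p q
    ≡⟨ cong₂ (λ u v → a * u + b * v + c * mulT f g p q) (mulT-timesXˡ f g p q) (mulT-timesZˡ f g p q) ⟩
  mulLin a b c (mulT f g) p q
    ∎
  where
  open ≡-Reasoning
  distribute : ∀ a b c x y z w → (a * x + b * y + c * z) * w ≡ a * (x * w) + b * (y * w) + c * (z * w)
  distribute = solve-∀ ℚ-ring

private
  mulT-one-firstRow : ∀ (g : Table) r q → ∑[ b < suc q ] (one 0 b * g r (q ℕ.∸ b)) ≡ g r q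
  mulT-one-firstRow g r q = trans (∑-head q (λ b → one 0 b * g r (q ℕ.∸ b)))
    (trans (cong₂ _+_ (ℚP.*-identityˡ (g r q)) (∑-zero q (λ b → ℚP.*-zeroˡ (g r (q ℕ.∸ suc b)))))
           (ℚP.+-identityʳ (g r q)))

mulT-oneˡ : ∀ g → mulT one g ≐ g
mulT-oneˡ g zero    q = trans (ℚP.+-identityˡ _) (mulT-one-firstRow g 0 q)
mulT-oneˡ g (suc p) q = trans (∑-head (suc p) _)
  (trans (cong₂ _+_ (mulT-one-firstRow g (suc p) q)
                    (∑-zero (suc p) (λ a → ∑-zero (suc q) (λ b → ℚP.*-zeroˡ (g (p ℕ.∸ a) (q ℕ.∸ b))))))
         (ℚP.+-identityʳ (g (suc p) q)))

mulT-mulLinʳ : ∀ a b c f g → mulT f (mulLin a b c g) ≐ mulLin a b c (mulT f g)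
mulT-mulLinʳ a b c f g = begin
  mulT f (mulLin a b c g)   ≈⟨ mulT-comm f (mulLin a b c g) ⟩
  mulT (mulLin a b c g) f   ≈⟨ mulT-mulLinˡ a b c g f ⟩
  mulLin a b c (mulT g f)   ≈⟨ mulLin-congʳ a b c (mulT-comm g f) ⟩
  mulLin a b c (mulT f g)   ∎
  where open ≐-Reasoning

mulT-oneʳ : ∀ f → mulT f one ≐ f
mulT-oneʳ f = ≐-trans (mulT-comm f one) (mulT-oneˡ f)

coeff1-add1 : ∀ P Q k → coeff1 (add1 P Q) k ≡ coeff1 P k ℤ.+ coeff1 Q k
coeff1-add1 []      Q       k       = sym (ℤP.+-identityˡ (coeff1 Q k))
coeff1-add1 (a ∷ P) []      k       = sym (ℤP.+-identityʳ (coeff1 (a ∷ P) k))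
coeff1-add1 (a ∷ P) (b ∷ Q) zero    = refl
coeff1-add1 (a ∷ P) (b ∷ Q) (suc k) = coeff1-add1 P Q k

coeff1-scale : ∀ a Q k → coeff1 (map (a ℤ.*_) Q) k ≡ a ℤ.* coeff1 Q k
coeff1-scale a []      k       = sym (ℤP.*-zeroʳ a)
coeff1-scale a (b ∷ Q) zero    = refl
coeff1-scale a (b ∷ Q) (suc k) = coeff1-scale a Q k

coeff1-mul1-[] : ∀ P k → coeff1 (mul1 P []) k ≡ + 0
coeff1-mul1-[] []      k       = refl
coeff1-mul1-[] (a ∷ P) zero    = refl
coeff1-mul1-[] (a ∷ P) (suc k) = coeff1-mul1-[] P k

coeff1-mul1 : ∀ P Q k →
  fromℤ (coeff1 (mul1 P Q) k) ≡ ∑[ a < suc k ] (fromℤ (coeff1 P a) * fromℤ (coeff1 Q (k ℕ.∸ a)))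
coeff1-mul1 []      Q k = sym (∑-zero (suc k) (λ a → ℚP.*-zeroˡ (fromℤ (coeff1 Q (k ℕ.∸ a)))))
coeff1-mul1 (c ∷ P) Q k = begin
  fromℤ (coeff1 (add1 (map (c ℤ.*_) Q) (+ 0 ∷ mul1 P Q)) k)
    ≡⟨ cong fromℤ (coeff1-add1 (map (c ℤ.*_) Q) (+ 0 ∷ mul1 P Q) k) ⟩
  fromℤ (coeff1 (map (c ℤ.*_) Q) k ℤ.+ coeff1 (+ 0 ∷ mul1 P Q) k)
    ≡⟨ fromℤ-+ (coeff1 (map (c ℤ.*_) Q) k) (coeff1 (+ 0 ∷ mul1 P Q) k) ⟩
  fromℤ (coeff1 (map (c ℤ.*_) Q) k) + fromℤ (coeff1 (+ 0 ∷ mul1 P Q) k)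
    ≡⟨ cong₂ _+_ (trans (cong fromℤ (coeff1-scale c Q k)) (fromℤ-* c (coeff1 Q k))) (shifted k) ⟩
  fromℤ c * fromℤ (coeff1 Q k) + ∑[ a < k ] (fromℤ (coeff1 P a) * fromℤ (coeff1 Q (k ℕ.∸ suc a)))
    ≡⟨ ∑-head k (λ a → fromℤ (coeff1 (c ∷ P) a) * fromℤ (coeff1 Q (k ℕ.∸ a))) ⟨
  ∑[ a < suc k ] (fromℤ (coeff1 (c ∷ P) a) * fromℤ (coeff1 Q (k ℕ.∸ a)))
    ∎
  where
  open ≡-Reasoning
  shifted : ∀ k → fromℤ (coeff1 (+ 0 ∷ mul1 P Q) k) ≡ ∑[ a < k ] (fromℤ (coeff1 P a) * fromℤ (coeff1 Q (k ℕ.∸ suc a)))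
  shifted zero    = refl
  shifted (suc k) = coeff1-mul1 P Q k

coeffX : P2 → ℕ → P1
coeffX []      p       = []
coeffX (a ∷ A) zero    = a
coeffX (a ∷ A) (suc p) = coeffX A p

coeff2-coeffX : ∀ A p q → coeff2 A p q ≡ coeff1 (coeffX A p) q
coeff2-coeffX []      p       q = refl
coeff2-coeffX (a ∷ A) zero    q = refl
coeff2-coeffX (a ∷ A) (suc p) q = coeff2-coeffX A p q

coeff2-add2 : ∀ A B p q → coeff2 (add2 A B) p q ≡ coeff2 A p q ℤ.+ coeff2 B p q
coeff2-add2 []      B       p       q = sym (ℤP.+-identityˡ (coeff2 B p q))
coeff2-add2 (a ∷ A) []      p       q = sym (ℤP.+-identityʳ (coeff2 (a ∷ A) p q))
coeff2-add2 (a ∷ A) (b ∷ B) zero    q = coeff1-add1 a b q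
coeff2-add2 (a ∷ A) (b ∷ B) (suc p) q = coeff2-add2 A B p q

coeff2-map-mul1 : ∀ P B p q → coeff2 (map (mul1 P) B) p q ≡ coeff1 (mul1 P (coeffX B p)) q
coeff2-map-mul1 P []      p       q = sym (coeff1-mul1-[] P q)
coeff2-map-mul1 P (b ∷ B) zero    q = refl
coeff2-map-mul1 P (b ∷ B) (suc p) q = coeff2-map-mul1 P B p q

coeffs-mul2 : ∀ A B → coeffs (mul2 A B) ≐ mulT (coeffs A) (coeffs B)
coeffs-mul2 []      B p q = sym (∑-zero (suc p) (λ a → ∑-zero (suc q) (λ b → ℚP.*-zeroˡ (coeffs B (p ℕ.∸ a) (q ℕ.∸ b)))))
coeffs-mul2 (P ∷ A) B p q = begin
  fromℤ (coeff2 (add2 (map (mul1 P) B) ([] ∷ mul2 A B)) p q)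
    ≡⟨ cong fromℤ (coeff2-add2 (map (mul1 P) B) ([] ∷ mul2 A B) p q) ⟩
  fromℤ (coeff2 (map (mul1 P) B) p q ℤ.+ coeff2 ([] ∷ mul2 A B) p q)
    ≡⟨ fromℤ-+ (coeff2 (map (mul1 P) B) p q) (coeff2 ([] ∷ mul2 A B) p q) ⟩
  fromℤ (coeff2 (map (mul1 P) B) p q) + coeffs ([] ∷ mul2 A B) p q
    ≡⟨ cong₂ _+_ firstRow (shifted p) ⟩
  ∑[ b < suc q ] (coeffs (P ∷ A) 0 b * coeffs B p (q ℕ.∸ b))
    + ∑[ a < p ] (∑[ b < suc q ] (coeffs A a b * coeffs B (p ℕ.∸ suc a) (q ℕ.∸ b)))
    ≡⟨ ∑-head p (λ a → ∑[ b < suc q ] (coeffs (P ∷ A) a b * coeffs B (p ℕ.∸ a) (q ℕ.∸ b))) ⟨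
  mulT (coeffs (P ∷ A)) (coeffs B) p q
    ∎
  where
  open ≡-Reasoning
  firstRow : fromℤ (coeff2 (map (mul1 P) B) p q) ≡ ∑[ b < suc q ] (coeffs (P ∷ A) 0 b * coeffs B p (q ℕ.∸ b))
  firstRow = trans (cong fromℤ (coeff2-map-mul1 P B p q)) (trans (coeff1-mul1 P (coeffX B p) q)
    (∑-cong (suc q) (λ b _ → cong (λ c → fromℤ (coeff1 P b) * fromℤ c) (sym (coeff2-coeffX B p (q ℕ.∸ b))))))
  shifted : ∀ p → coeffs ([] ∷ mul2 A B) p q
                ≡ ∑[ a < p ] (∑[ b < suc q ] (coeffs A a b * coeffs B (p ℕ.∸ suc a) (q ℕ.∸ b)))
  shifted zero    = refl
  shifted (suc p) = coeffs-mul2 A B p q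

coeffs-lin : ∀ a b c → coeffs (lin a b c) ≐ mulLin (fromℤ a) (fromℤ b) (fromℤ c) one
coeffs-lin a b c zero          zero          = sym (only-c (fromℤ a) (fromℤ b) (fromℤ c))
  where only-c : ∀ a b c → a * 0ℚ + b * 0ℚ + c * 1ℚ ≡ c
        only-c = solve-∀ ℚ-ring
coeffs-lin a b c zero          (suc zero)    = sym (only-b (fromℤ a) (fromℤ b) (fromℤ c))
  where only-b : ∀ a b c → a * 0ℚ + b * 1ℚ + c * 0ℚ ≡ b
        only-b = solve-∀ ℚ-ring
coeffs-lin a b c (suc zero)    zero          = sym (only-a (fromℤ a) (fromℤ b) (fromℤ c))
  where only-a : ∀ a b c → a * 1ℚ + b * 0ℚ + c * 0ℚ ≡ a
        only-a = solve-∀ ℚ-ring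
coeffs-lin a b c zero          (suc (suc q)) = sym (combination-of-zeros (fromℤ a) (fromℤ b) (fromℤ c))
coeffs-lin a b c (suc zero)    (suc q)       = sym (combination-of-zeros (fromℤ a) (fromℤ b) (fromℤ c))
coeffs-lin a b c (suc (suc p)) zero          = sym (combination-of-zeros (fromℤ a) (fromℤ b) (fromℤ c))
coeffs-lin a b c (suc (suc p)) (suc q)       = sym (combination-of-zeros (fromℤ a) (fromℤ b) (fromℤ c))

mulLins : (A B C : ℕ → ℚ) → ℕ → Table → Table
mulLins A B C zero    f = f
mulLins A B C (suc k) f = mulLin (A k) (B k) (C k) (mulLins A B C k f)

mulLins-cong : ∀ {A B C A′ B′ C′ : ℕ → ℚ} k {f g} →
  (∀ i → i ℕ.< k → A i ≡ A′ i) → (∀ i → i ℕ.< k → B i ≡ B′ i) → (∀ i → i ℕ.< k → C i ≡ C′ i) →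
  f ≐ g → mulLins A B C k f ≐ mulLins A′ B′ C′ k g
mulLins-cong zero    A≡ B≡ C≡ f≐g = f≐g
mulLins-cong (suc k) A≡ B≡ C≡ f≐g =
  mulLin-cong (A≡ k (ℕP.n<1+n k)) (B≡ k (ℕP.n<1+n k)) (C≡ k (ℕP.n<1+n k))
    (mulLins-cong k (λ i i<k → A≡ i (ℕP.m<n⇒m<1+n i<k)) (λ i i<k → B≡ i (ℕP.m<n⇒m<1+n i<k))
                    (λ i i<k → C≡ i (ℕP.m<n⇒m<1+n i<k)) f≐g)

mulLins-congʳ : ∀ A B C k {f g} → f ≐ g → mulLins A B C k f ≐ mulLins A B C k g
mulLins-congʳ A B C k = mulLins-cong k (λ _ _ → refl) (λ _ _ → refl) (λ _ _ → refl)

mulLins-mulLin : ∀ A B C k a b c f → mulLins A B C k (mulLin a b c f) ≐ mulLin a b c (mulLins A B C k f)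
mulLins-mulLin A B C zero    a b c f = ≐-refl
mulLins-mulLin A B C (suc k) a b c f =
  ≐-trans (mulLin-congʳ (A k) (B k) (C k) (mulLins-mulLin A B C k a b c f))
          (mulLin-comm (A k) (B k) (C k) a b c (mulLins A B C k f))

mulLins-first : ∀ A B C k f →
  mulLins A B C (suc k) f ≐ mulLins (A ∘ suc) (B ∘ suc) (C ∘ suc) k (mulLin (A 0) (B 0) (C 0) f)
mulLins-first A B C zero    f = ≐-refl
mulLins-first A B C (suc k) f = mulLin-congʳ (A (suc k)) (B (suc k)) (C (suc k)) (mulLins-first A B C k f)

mulLins-reverse : ∀ A B C k f →
  mulLins A B C k f ≐ mulLins (λ i → A (k ℕ.∸ suc i)) (λ i → B (k ℕ.∸ suc i)) (λ i → C (k ℕ.∸ suc i)) k f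
mulLins-reverse A B C zero    f = ≐-refl
mulLins-reverse A B C (suc k) f = begin
  mulLin (A k) (B k) (C k) (mulLins A B C k f)
    ≈⟨ mulLin-congʳ (A k) (B k) (C k) (mulLins-reverse A B C k f) ⟩
  mulLin (A k) (B k) (C k) (mulLins A′ B′ C′ k f)
    ≈⟨ mulLins-mulLin A′ B′ C′ k (A k) (B k) (C k) f ⟨
  mulLins A′ B′ C′ k (mulLin (A k) (B k) (C k) f)
    ≈⟨ mulLins-first (λ i → A (k ℕ.∸ i)) (λ i → B (k ℕ.∸ i)) (λ i → C (k ℕ.∸ i)) k f ⟨
  mulLins (λ i → A (k ℕ.∸ i)) (λ i → B (k ℕ.∸ i)) (λ i → C (k ℕ.∸ i)) (suc k) f
    ∎
  where
  open ≐-Reasoning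
  A′ B′ C′ : ℕ → ℚ
  A′ i = A (k ℕ.∸ suc i)
  B′ i = B (k ℕ.∸ suc i)
  C′ i = C (k ℕ.∸ suc i)

mulT-mulLinsˡ : ∀ A B C k f g → mulT (mulLins A B C k f) g ≐ mulLins A B C k (mulT f g)
mulT-mulLinsˡ A B C zero    f g = ≐-refl
mulT-mulLinsˡ A B C (suc k) f g =
  ≐-trans (mulT-mulLinˡ (A k) (B k) (C k) (mulLins A B C k f) g)
          (mulLin-congʳ (A k) (B k) (C k) (mulT-mulLinsˡ A B C k f g))

mulLins-as-mulT : ∀ A B C k g → mulLins A B C k g ≐ mulT (mulLins A B C k one) g
mulLins-as-mulT A B C k g =
  ≐-sym (≐-trans (mulT-mulLinsˡ A B C k one g) (mulLins-congʳ A B C k (mulT-oneˡ g)))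

timesX-scaleT : ∀ x f → timesX (scaleT x f) ≐ scaleT x (timesX f)
timesX-scaleT x f zero    q = sym (ℚP.*-zeroʳ x)
timesX-scaleT x f (suc p) q = refl

timesZ-scaleT : ∀ x f → timesZ (scaleT x f) ≐ scaleT x (timesZ f)
timesZ-scaleT x f p zero    = sym (ℚP.*-zeroʳ x)
timesZ-scaleT x f p (suc q) = refl

mulLin-scaleT : ∀ a b c x f → mulLin a b c (scaleT x f) ≐ scaleT x (mulLin a b c f)
mulLin-scaleT a b c x f p q =
  trans (cong₂ (λ u v → a * u + b * v + c * (x * f p q)) (timesX-scaleT x f p q) (timesZ-scaleT x f p q))
        (pull-out a b c x (timesX f p q) (timesZ f p q) (f p q))
  where pull-out : ∀ a b c x u v w → a * (x * u) + b * (x * v) + c * (x * w) ≡ x * (a * u + b * v + c * w)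
        pull-out = solve-∀ ℚ-ring

mulLin-homogeneous : ∀ a b c x f → mulLin (x * a) (x * b) (x * c) f ≐ scaleT x (mulLin a b c f)
mulLin-homogeneous a b c x f p q = pull-out a b c x (timesX f p q) (timesZ f p q) (f p q)
  where pull-out : ∀ a b c x u v w → x * a * u + x * b * v + x * c * w ≡ x * (a * u + b * v + c * w)
        pull-out = solve-∀ ℚ-ring

mulLins-homogeneous : ∀ c A B C k f →
  mulLins (λ i → fromℕ c * A i) (λ i → fromℕ c * B i) (λ i → fromℕ c * C i) k f
    ≐ scaleT (fromℕ (c ℕ.^ k)) (mulLins A B C k f)
mulLins-homogeneous c A B C zero    f p q = sym (ℚP.*-identityˡ (f p q))
mulLins-homogeneous c A B C (suc k) f = begin
  mulLin (x * A k) (x * B k) (x * C k) (mulLins (λ i → x * A i) (λ i → x * B i) (λ i → x * C i) k f)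
    ≈⟨ mulLin-homogeneous (A k) (B k) (C k) x _ ⟩
  scaleT x (mulLin (A k) (B k) (C k) (mulLins (λ i → x * A i) (λ i → x * B i) (λ i → x * C i) k f))
    ≈⟨ scaleT-cong x (mulLin-congʳ (A k) (B k) (C k) (mulLins-homogeneous c A B C k f)) ⟩
  scaleT x (mulLin (A k) (B k) (C k) (scaleT (fromℕ (c ℕ.^ k)) (mulLins A B C k f)))
    ≈⟨ scaleT-cong x (mulLin-scaleT (A k) (B k) (C k) (fromℕ (c ℕ.^ k)) (mulLins A B C k f)) ⟩
  scaleT x (scaleT (fromℕ (c ℕ.^ k)) (mulLins A B C (suc k) f))
    ≈⟨ (λ p q → trans (sym (ℚP.*-assoc x _ _)) (cong (_* mulLins A B C (suc k) f p q) (sym (fromℕ-* c (c ℕ.^ k))))) ⟩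
  scaleT (fromℕ (c ℕ.^ suc k)) (mulLins A B C (suc k) f)
    ∎
  where
  open ≐-Reasoning
  x = fromℕ c

coeffs-rise : ∀ a b c k → coeffs (rise a b c k) ≐ mulLins (λ _ → fromℤ a) (λ _ → fromℤ b) (λ i → fromℤ c + fromℕ i) k one
coeffs-rise a b c zero    zero    zero    = refl
coeffs-rise a b c zero    zero    (suc q) = refl
coeffs-rise a b c zero    (suc p) q       = refl
coeffs-rise a b c (suc k) = begin
  coeffs (mul2 (rise a b c k) (lin a b (c ℤ.+ + k)))
    ≈⟨ coeffs-mul2 (rise a b c k) (lin a b (c ℤ.+ + k)) ⟩
  mulT (coeffs (rise a b c k)) (coeffs (lin a b (c ℤ.+ + k)))
    ≈⟨ mulT-cong (coeffs-rise a b c k) (coeffs-lin a b (c ℤ.+ + k)) ⟩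
  mulT (mulLins A B C k one) (mulLin (fromℤ a) (fromℤ b) (fromℤ (c ℤ.+ + k)) one)
    ≈⟨ mulT-mulLinʳ (fromℤ a) (fromℤ b) (fromℤ (c ℤ.+ + k)) (mulLins A B C k one) one ⟩
  mulLin (fromℤ a) (fromℤ b) (fromℤ (c ℤ.+ + k)) (mulT (mulLins A B C k one) one)
    ≈⟨ mulLin-cong {fromℤ a} {fromℤ b} refl refl (fromℤ-+ c (+ k)) (mulT-oneʳ (mulLins A B C k one)) ⟩
  mulLins A B C (suc k) one
    ∎
  where
  open ≐-Reasoning
  A B C : ℕ → ℚ
  A _ = fromℤ a
  B _ = fromℤ b
  C i = fromℤ c + fromℕ i

coeffs-rise-mul2 : ∀ a b c k X →
  coeffs (mul2 (rise a b c k) X) ≐ mulLins (λ _ → fromℤ a) (λ _ → fromℤ b) (λ i → fromℤ c + fromℕ i) k (coeffs X)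
coeffs-rise-mul2 a b c k X =
  ≐-trans (coeffs-mul2 (rise a b c k) X)
  (≐-trans (mulT-congˡ (coeffs X) (coeffs-rise a b c k))
           (≐-sym (mulLins-as-mulT (λ _ → fromℤ a) (λ _ → fromℤ b) (λ i → fromℤ c + fromℕ i) k (coeffs X))))

affineProd : ℚ → ℚ → ℚ → ℕ → Table
affineProd c σ b k = mulLins (λ i → c + σ * fromℕ i) (λ _ → b) (λ _ → 1ℚ) k one

mulLins-rising-as-mulT : ∀ c c′ B k X → c + fromℕ k - 1ℚ ≡ c′ →
  mulLins (λ i → c + fromℕ i) (λ _ → B) (λ _ → 1ℚ) k X ≐ mulT (affineProd c′ (- 1ℚ) B k) X
mulLins-rising-as-mulT c c′ B k X refl = begin
  mulLins (λ i → c + fromℕ i) (λ _ → B) (λ _ → 1ℚ) k X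
    ≈⟨ mulLins-reverse (λ i → c + fromℕ i) (λ _ → B) (λ _ → 1ℚ) k X ⟩
  mulLins (λ i → c + fromℕ (k ℕ.∸ suc i)) (λ _ → B) (λ _ → 1ℚ) k X
    ≈⟨ mulLins-cong k reversed (λ _ _ → refl) (λ _ _ → refl) ≐-refl ⟩
  mulLins (λ i → c′ + - 1ℚ * fromℕ i) (λ _ → B) (λ _ → 1ℚ) k X
    ≈⟨ mulLins-as-mulT (λ i → c′ + - 1ℚ * fromℕ i) (λ _ → B) (λ _ → 1ℚ) k X ⟩
  mulT (affineProd c′ (- 1ℚ) B k) X
    ∎
  where
  open ≐-Reasoning
  cancel : ∀ c i d → c + d ≡ c + (1ℚ + i + d) - 1ℚ + - 1ℚ * i
  cancel = solve-∀ ℚ-ring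
  reversed : ∀ i → i ℕ.< k → c + fromℕ (k ℕ.∸ suc i) ≡ c′ + - 1ℚ * fromℕ i
  reversed i i<k = trans (cancel c (fromℕ i) (fromℕ (k ℕ.∸ suc i)))
    (cong (λ K → c + K - 1ℚ + - 1ℚ * fromℕ i)
      (trans (cong (_+ fromℕ (k ℕ.∸ suc i)) (sym (fromℕ-suc i)))
             (trans (sym (fromℕ-+ (suc i) (k ℕ.∸ suc i))) (cong fromℕ (ℕP.m+[n∸m]≡n i<k)))))

mulLins-rising-halved : ∀ c B k X →
  mulLins (λ i → c + fromℕ i) (λ _ → B) (λ _ → fromℕ 2) k X
    ≐ scaleT (fromℕ (2 ℕ.^ k)) (mulT (affineProd (½ * c) ½ (½ * B) k) X)
mulLins-rising-halved c B k X = begin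
  mulLins (λ i → c + fromℕ i) (λ _ → B) (λ _ → fromℕ 2) k X
    ≈⟨ mulLins-cong k (λ i _ → sym (trans (cong (fromℕ 2 *_) (sym (ℚP.*-distribˡ-+ ½ c (fromℕ i)))) (double-half (c + fromℕ i))))
                      (λ _ _ → sym (double-half B)) (λ _ _ → sym (ℚP.*-identityʳ (fromℕ 2))) ≐-refl ⟩
  mulLins (λ i → fromℕ 2 * (½ * c + ½ * fromℕ i)) (λ _ → fromℕ 2 * (½ * B)) (λ _ → fromℕ 2 * 1ℚ) k X
    ≈⟨ mulLins-homogeneous 2 (λ i → ½ * c + ½ * fromℕ i) (λ _ → ½ * B) (λ _ → 1ℚ) k X ⟩
  scaleT (fromℕ (2 ℕ.^ k)) (mulLins (λ i → ½ * c + ½ * fromℕ i) (λ _ → ½ * B) (λ _ → 1ℚ) k X)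
    ≈⟨ scaleT-cong (fromℕ (2 ℕ.^ k)) (mulLins-as-mulT (λ i → ½ * c + ½ * fromℕ i) (λ _ → ½ * B) (λ _ → 1ℚ) k X) ⟩
  scaleT (fromℕ (2 ℕ.^ k)) (mulT (affineProd (½ * c) ½ (½ * B) k) X)
    ∎
  where open ≐-Reasoning

-- Total degree and the reciprocal polynomial

Deg≤ : ℕ → Table → Set
Deg≤ K f = ∀ p q → K ℕ.< p ℕ.+ q → f p q ≡ 0ℚ

Deg≤-one : Deg≤ 0 one
Deg≤-one zero    zero    ()
Deg≤-one zero    (suc q) _ = refl
Deg≤-one (suc p) q       _ = refl

Deg≤-mulLin : ∀ {K} a b c {f} → Deg≤ K f → Deg≤ (suc K) (mulLin a b c f)
Deg≤-mulLin {K} a b c {f} deg p q K<p+q =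
  trans (cong₂ (λ u v → a * u + b * v + c * f p q) (x-part p K<p+q) (z-part q K<p+q))
        (trans (cong (λ w → a * 0ℚ + b * 0ℚ + c * w) (deg p q (ℕP.<-trans (ℕP.n<1+n K) K<p+q)))
               (combination-of-zeros a b c))
  where
  x-part : ∀ p → suc K ℕ.< p ℕ.+ q → timesX f p q ≡ 0ℚ
  x-part zero    _            = refl
  x-part (suc p) (s≤s K<p+q) = deg p q K<p+q
  z-part : ∀ q → suc K ℕ.< p ℕ.+ q → timesZ f p q ≡ 0ℚ
  z-part zero    _       = refl
  z-part (suc q) K<p+q+1 = deg p q (ℕP.≤-pred (ℕP.≤-trans K<p+q+1 (ℕP.≤-reflexive (ℕP.+-suc p q))))

Deg≤-mulLins : ∀ A B C k {K f} → Deg≤ K f → Deg≤ (k ℕ.+ K) (mulLins A B C k f)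
Deg≤-mulLins A B C zero    deg = deg
Deg≤-mulLins A B C (suc k) deg = Deg≤-mulLin (A k) (B k) (C k) (Deg≤-mulLins A B C k deg)

atComplement : ℕ → ℕ → (ℕ → ℚ) → ℚ
atComplement K       zero    h = h K
atComplement zero    (suc i) h = 0ℚ
atComplement (suc K) (suc i) h = atComplement K i h

-- x^K f(1/x, z/x): the coefficient of x^t z^s is that of x^(K-t-s) z^s in f, and 0 when t + s > K
reciprocal : ℕ → Table → Table
reciprocal K f t s = atComplement K (t ℕ.+ s) (λ p → f p s)

atComplement-cong : ∀ K i {g h : ℕ → ℚ} → (∀ p → g p ≡ h p) → atComplement K i g ≡ atComplement K i h
atComplement-cong K       zero    g≗h = g≗h K
atComplement-cong zero    (suc i) g≗h = refl
atComplement-cong (suc K) (suc i) g≗h = atComplement-cong K i g≗h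

atComplement-linear₃ : ∀ K i a b c (f g h : ℕ → ℚ) →
  atComplement K i (λ p → a * f p + b * g p + c * h p)
    ≡ a * atComplement K i f + b * atComplement K i g + c * atComplement K i h
atComplement-linear₃ K       zero    a b c f g h = refl
atComplement-linear₃ zero    (suc i) a b c f g h = sym (combination-of-zeros a b c)
atComplement-linear₃ (suc K) (suc i) a b c f g h = atComplement-linear₃ K i a b c f g h

atComplement-timesX : ∀ K i f s → atComplement (suc K) i (λ p → timesX f p s) ≡ atComplement K i (λ p → f p s)
atComplement-timesX K       zero          f s = refl
atComplement-timesX zero    (suc zero)    f s = refl
atComplement-timesX zero    (suc (suc i)) f s = refl
atComplement-timesX (suc K) (suc i)       f s = atComplement-timesX K i f s

atComplement-vanishing : ∀ K i (h : ℕ → ℚ) → (∀ p → p ℕ.+ i ≡ K → h p ≡ 0ℚ) → atComplement K i h ≡ 0ℚ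
atComplement-vanishing K       zero    h vanish = vanish K (ℕP.+-identityʳ K)
atComplement-vanishing zero    (suc i) h vanish = refl
atComplement-vanishing (suc K) (suc i) h vanish =
  atComplement-vanishing K i h (λ p p+i≡K → vanish p (trans (ℕP.+-suc p i) (cong suc p+i≡K)))

atComplement-≤ : ∀ K i (h : ℕ → ℚ) → i ℕ.≤ K → atComplement K i h ≡ h (K ℕ.∸ i)
atComplement-≤ K       zero    h i≤K       = refl
atComplement-≤ (suc K) (suc i) h (s≤s i≤K) = atComplement-≤ K i h i≤K

reciprocal-one : reciprocal 0 one ≐ one
reciprocal-one zero    zero    = refl
reciprocal-one zero    (suc s) = refl
reciprocal-one (suc t) s       = refl

reciprocal-mulLin : ∀ {K} a b c {f} → Deg≤ K f → reciprocal (suc K) (mulLin a b c f) ≐ mulLin c b a (reciprocal K f)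
reciprocal-mulLin {K} a b c {f} deg t s = begin
  atComplement (suc K) (t ℕ.+ s) (λ p → a * timesX f p s + b * timesZ f p s + c * f p s)
    ≡⟨ atComplement-linear₃ (suc K) (t ℕ.+ s) a b c _ _ _ ⟩
  a * atComplement (suc K) (t ℕ.+ s) (λ p → timesX f p s) + b * atComplement (suc K) (t ℕ.+ s) (λ p → timesZ f p s)
    + c * atComplement (suc K) (t ℕ.+ s) (λ p → f p s)
    ≡⟨ cong₂ (λ u v → a * u + b * v + c * atComplement (suc K) (t ℕ.+ s) (λ p → f p s))
             (atComplement-timesX K (t ℕ.+ s) f s) (z-part s) ⟩
  a * reciprocal K f t s + b * timesZ (reciprocal K f) t s + c * atComplement (suc K) (t ℕ.+ s) (λ p → f p s)
    ≡⟨ cong (λ w → a * reciprocal K f t s + b * timesZ (reciprocal K f) t s + c * w) (constant-part t) ⟩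
  a * reciprocal K f t s + b * timesZ (reciprocal K f) t s + c * timesX (reciprocal K f) t s
    ≡⟨ reorder a b c _ _ _ ⟩
  mulLin c b a (reciprocal K f) t s
    ∎
  where
  open ≡-Reasoning
  reorder : ∀ a b c x y z → a * x + b * y + c * z ≡ c * z + b * y + a * x
  reorder = solve-∀ ℚ-ring
  z-part : ∀ s → atComplement (suc K) (t ℕ.+ s) (λ p → timesZ f p s) ≡ timesZ (reciprocal K f) t s
  z-part zero    = atComplement-vanishing (suc K) (t ℕ.+ 0) (λ _ → 0ℚ) (λ _ _ → refl)
  z-part (suc s) = cong (λ i → atComplement (suc K) i (λ p → f p s)) (ℕP.+-suc t s)
  constant-part : ∀ t → atComplement (suc K) (t ℕ.+ s) (λ p → f p s) ≡ timesX (reciprocal K f) t s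
  constant-part zero    = atComplement-vanishing (suc K) s (λ p → f p s)
    (λ p p+s≡K+1 → deg p s (ℕP.≤-reflexive (sym p+s≡K+1)))
  constant-part (suc t) = refl

reciprocal-mulLins : ∀ A B C k {K f} → Deg≤ K f →
  reciprocal (k ℕ.+ K) (mulLins A B C k f) ≐ mulLins C B A k (reciprocal K f)
reciprocal-mulLins A B C zero    deg = ≐-refl
reciprocal-mulLins A B C (suc k) deg =
  ≐-trans (reciprocal-mulLin (A k) (B k) (C k) (Deg≤-mulLins A B C k deg))
          (mulLin-congʳ (C k) (B k) (A k) (reciprocal-mulLins A B C k deg))

reciprocal-coefficient : ∀ K f t p q → K ≡ t ℕ.+ q ℕ.+ p → reciprocal K f t q ≡ f p q
reciprocal-coefficient K f t p q refl =
  trans (atComplement-≤ (t ℕ.+ q ℕ.+ p) (t ℕ.+ q) (λ p′ → f p′ q) (ℕP.m≤m+n (t ℕ.+ q) p))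
        (cong (λ p′ → f p′ q) (ℕP.m+n∸m≡n (t ℕ.+ q) p))

reciprocal-cong : ∀ K {f g} → f ≐ g → reciprocal K f ≐ reciprocal K g
reciprocal-cong K f≐g t s = atComplement-cong K (t ℕ.+ s) (λ p → f≐g p s)

-- x carries weight 2 because the x-coefficients of the factors grow linearly with the index.
record PolyFamily (w : ℕ) (X : ℕ → Table) : Set where
  constructor polyFamily
  field coefficientPoly : ∀ t s → IsPoly (w ℕ.+ (2 ℕ.* t ℕ.+ s)) (λ j → X j t s)

open PolyFamily public

module _ (c σ b : ℚ) where

  private
    A : ℕ → ℚ
    A i = c + σ * fromℕ i

    increment : ℕ → Table
    increment i t s = A i * timesX (affineProd c σ b i) t s + b * timesZ (affineProd c σ b i) t s

  affineProd-telescope : ∀ t s k → affineProd c σ b k t s ≡ one t s + ∑[ i < k ] increment i t s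
  affineProd-telescope t s = ∑-telescope (λ k → affineProd c σ b k t s) (λ i → increment i t s)
    (λ i → regroup (A i) b (timesX (affineProd c σ b i) t s) (timesZ (affineProd c σ b i) t s) (affineProd c σ b i t s))
    where regroup : ∀ a b x z f → a * x + b * z + 1ℚ * f ≡ f + (a * x + b * z)
          regroup = solve-∀ ℚ-ring

  private
    mutual
      affineProd-coefficientPoly : ∀ t s → IsPoly (suc (2 ℕ.* t ℕ.+ s)) (λ k → affineProd c σ b k t s)
      affineProd-coefficientPoly t s = IsPoly-ext (λ k → sym (affineProd-telescope t s k))
        (IsPoly-+ (IsPoly-mono (s≤s z≤n) (IsPoly-const (one t s)))
                  (IsPoly-prefixSum (IsPoly-+ (x-increment t s) (z-increment t s))))

      x-increment : ∀ t s → IsPoly (2 ℕ.* t ℕ.+ s) (λ i → A i * timesX (affineProd c σ b i) t s)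
      x-increment zero    s = IsPoly-zero (λ i → ℚP.*-zeroʳ (A i))
      x-increment (suc t) s = IsPoly-mono (ℕP.≤-reflexive (weight t s))
                                          (IsPoly-* (IsPoly-affine c σ) (affineProd-coefficientPoly t s))
        where weight : ∀ t s → 1 ℕ.+ (1 ℕ.+ (2 ℕ.* t ℕ.+ s)) ≡ 2 ℕ.* suc t ℕ.+ s
              weight = ℕ-Solver.solve-∀

      z-increment : ∀ t s → IsPoly (2 ℕ.* t ℕ.+ s) (λ i → b * timesZ (affineProd c σ b i) t s)
      z-increment t zero    = IsPoly-zero (λ i → ℚP.*-zeroʳ b)
      z-increment t (suc s) = IsPoly-mono (ℕP.≤-reflexive (sym (ℕP.+-suc (2 ℕ.* t) s)))
                                          (IsPoly-scale b (affineProd-coefficientPoly t s))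

  PolyFamily-affineProd : PolyFamily 1 (affineProd c σ b)
  PolyFamily-affineProd = polyFamily affineProd-coefficientPoly

PolyFamily-scaleT : ∀ {w X} c → PolyFamily w X → PolyFamily w (λ j → scaleT c (X j))
PolyFamily-scaleT c (polyFamily polyX) = polyFamily λ t s → IsPoly-scale c (polyX t s)

PolyFamily-mulT : ∀ {a b X Y} → PolyFamily (suc a) X → PolyFamily b Y → PolyFamily (a ℕ.+ b) (λ j → mulT (X j) (Y j))
PolyFamily-mulT {a} {b} (polyFamily polyX) (polyFamily polyY) = polyFamily λ t s →
  IsPoly-∑ (suc t) _ (λ t₁ t₁≤t → IsPoly-∑ (suc s) _ (λ s₁ s₁≤s →
    IsPoly-mono (ℕP.≤-reflexive (trans (additive a b t₁ s₁ (t ℕ.∸ t₁) (s ℕ.∸ s₁))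
                                       (cong₂ (λ t′ s′ → a ℕ.+ b ℕ.+ (2 ℕ.* t′ ℕ.+ s′))
                                              (ℕP.m+[n∸m]≡n (ℕP.≤-pred t₁≤t)) (ℕP.m+[n∸m]≡n (ℕP.≤-pred s₁≤s)))))
      (IsPoly-* (polyX t₁ s₁) (polyY (t ℕ.∸ t₁) (s ℕ.∸ s₁)))))
  where
  additive : ∀ a b t₁ s₁ t₂ s₂ →
    a ℕ.+ (2 ℕ.* t₁ ℕ.+ s₁) ℕ.+ (b ℕ.+ (2 ℕ.* t₂ ℕ.+ s₂)) ≡ a ℕ.+ b ℕ.+ (2 ℕ.* (t₁ ℕ.+ t₂) ℕ.+ (s₁ ℕ.+ s₂))
  additive = ℕ-Solver.solve-∀

-- Evaluates the coefficient polynomials of X at u + v j, which need not be a natural number.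
atAffine : ∀ {w X} → PolyFamily w X → ℚ → ℚ → ℕ → Table
atAffine (polyFamily polyX) u v j t s = evalℚ (proj₁ (polyX t s)) (u + v * fromℕ j)

PolyFamily-atAffine : ∀ {w X} (polyX : PolyFamily w X) u v → PolyFamily w (atAffine polyX u v)
PolyFamily-atAffine (polyFamily polyX) u v = polyFamily λ t s →
  IsPoly-mono (proj₁ (proj₂ (polyX t s))) (IsPoly-composeAffine (proj₁ (polyX t s)) u v)

atAffine-agrees : ∀ {w X} (polyX : PolyFamily w X) u v j k → fromℕ k ≡ u + v * fromℕ j → atAffine polyX u v j ≐ X k
atAffine-agrees (polyFamily polyX) u v j k k≡u+vj t s =
  trans (cong (evalℚ (proj₁ (polyX t s))) (sym k≡u+vj)) (sym (proj₂ (proj₂ (polyX t s)) k))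

private
  linearForm-coefficientPoly : ∀ u v b t s → IsPoly (2 ℕ.* t ℕ.+ s) (λ j → mulLin (u + v * fromℕ j) b 0ℚ one t s)
  linearForm-coefficientPoly u v b zero          zero          = IsPoly-zero (λ j → combination-of-zeros (u + v * fromℕ j) b 1ℚ)
  linearForm-coefficientPoly u v b zero          (suc zero)    = IsPoly-ext (λ j → sym (only-b (u + v * fromℕ j) b)) (IsPoly-const b)
    where only-b : ∀ a b → a * 0ℚ + b * 1ℚ + 0ℚ * 0ℚ ≡ b
          only-b = solve-∀ ℚ-ring
  linearForm-coefficientPoly u v b zero          (suc (suc s)) = IsPoly-zero (λ j → combination-of-zeros (u + v * fromℕ j) b 0ℚ)
  linearForm-coefficientPoly u v b (suc zero)    zero          = IsPoly-ext (λ j → sym (only-a (u + v * fromℕ j) b)) (IsPoly-affine u v)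
    where only-a : ∀ a b → a * 1ℚ + b * 0ℚ + 0ℚ * 0ℚ ≡ a
          only-a = solve-∀ ℚ-ring
  linearForm-coefficientPoly u v b (suc zero)    (suc s)       = IsPoly-zero (λ j → combination-of-zeros (u + v * fromℕ j) b 0ℚ)
  linearForm-coefficientPoly u v b (suc (suc t)) zero          = IsPoly-zero (λ j → combination-of-zeros (u + v * fromℕ j) b 0ℚ)
  linearForm-coefficientPoly u v b (suc (suc t)) (suc s)       = IsPoly-zero (λ j → combination-of-zeros (u + v * fromℕ j) b 0ℚ)

PolyFamily-linearForm : ∀ u v b → PolyFamily 0 (λ j → mulLin (u + v * fromℕ j) b 0ℚ one)
PolyFamily-linearForm u v b = polyFamily (linearForm-coefficientPoly u v b)

module _ (n : ℕ) (m : ℤ) where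

  dualLinearFactor : ℕ → Table
  dualLinearFactor j = mulLin (fromℤ m + fromℕ 3 * fromℕ j) (fromℤ (ℤ.- + 3)) 0ℚ one

  dualBase₁ dualBase₂ dualBase₃ : ℚ
  dualBase₁ = ½ * fromℤ (m ℤ.+ + 1)
  dualBase₂ = 0ℚ
  dualBase₃ = fromℤ m + fromℕ (2 ℕ.* n) - 1ℚ

  affineProd₁-poly : PolyFamily 1 (affineProd dualBase₁ ½ (½ * 1ℚ))
  affineProd₁-poly = PolyFamily-affineProd dualBase₁ ½ (½ * 1ℚ)
  affineProd₂-poly : PolyFamily 1 (affineProd dualBase₂ (- 1ℚ) (fromℕ 2))
  affineProd₂-poly = PolyFamily-affineProd dualBase₂ (- 1ℚ) (fromℕ 2)
  affineProd₃-poly : PolyFamily 1 (affineProd dualBase₃ (- 1ℚ) (fromℤ (ℤ.- + 1)))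
  affineProd₃-poly = PolyFamily-affineProd dualBase₃ (- 1ℚ) (fromℤ (ℤ.- + 1))

  -- affineProd extended to all j from the numbers of factors of the three rising factorials of expr,
  -- which for j = k + 1 are k, k and 2n - 2j - 2.
  dualFactor₁ dualFactor₂ dualFactor₃ : ℕ → Table
  dualFactor₁ = atAffine affineProd₁-poly (- 1ℚ) 1ℚ
  dualFactor₂ = atAffine affineProd₂-poly (- 1ℚ) 1ℚ
  dualFactor₃ = atAffine affineProd₃-poly (fromℕ (2 ℕ.* n) - fromℕ 2) (- fromℕ 2)

  dualProduct : ℕ → Table
  dualProduct j = scaleT ½ (mulT (dualFactor₁ j) (mulT (dualFactor₂ j) (mulT (dualFactor₃ j) (dualLinearFactor j))))

  PolyFamily-dualProduct : PolyFamily 0 dualProduct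
  PolyFamily-dualProduct = PolyFamily-scaleT ½
    (PolyFamily-mulT (PolyFamily-atAffine affineProd₁-poly (- 1ℚ) 1ℚ)
      (PolyFamily-mulT (PolyFamily-atAffine affineProd₂-poly (- 1ℚ) 1ℚ)
        (PolyFamily-mulT (PolyFamily-atAffine affineProd₃-poly (fromℕ (2 ℕ.* n) - fromℕ 2) (- fromℕ 2))
          (PolyFamily-linearForm (fromℤ m) (fromℕ 3) (fromℤ (ℤ.- + 3))))))

  module _ (k : ℕ) where

    private
      j k₃ : ℕ
      j  = suc k
      k₃ = 2 ℕ.* n ℕ.∸ 2 ℕ.* j ℕ.∸ 2

      base₁ base₂ base₃ : ℚ
      base₁ = fromℤ (m ℤ.+ + 1)
      base₂ = fromℤ (ℤ.- (+ j) ℤ.+ + 2)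
      base₃ = fromℤ (m ℤ.+ + (2 ℕ.* j) ℤ.+ + 2)

      rising : ℚ → ℕ → ℚ
      rising c i = c + fromℕ i

      const : ℚ → ℕ → ℚ
      const c _ = c

      linearFactor : Table
      linearFactor = mulLin 0ℚ (fromℤ (ℤ.- + 3)) (fromℤ (m ℤ.+ + (3 ℕ.* j))) one

    coeffs-expr : coeffs (expr n m j) ≐
      mulLins (const (fromℕ 2)) (const 1ℚ) (rising base₁) k
        (mulLins (const 1ℚ) (const (fromℕ 2)) (rising base₂) k
          (mulLins (const 1ℚ) (const (fromℤ (ℤ.- + 1))) (rising base₃) k₃ linearFactor))
    coeffs-expr =
      ≐-trans (coeffs-rise-mul2 (+ 2) (+ 1) (m ℤ.+ + 1) k _)
        (mulLins-congʳ _ _ _ k (≐-trans (coeffs-rise-mul2 (+ 1) (+ 2) (ℤ.- (+ j) ℤ.+ + 2) k _)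
          (mulLins-congʳ _ _ _ k (≐-trans (coeffs-rise-mul2 (+ 1) (ℤ.- + 1) (m ℤ.+ + (2 ℕ.* j) ℤ.+ + 2) k₃ _)
            (mulLins-congʳ _ _ _ k₃ (coeffs-lin (+ 0) (ℤ.- + 3) (m ℤ.+ + (3 ℕ.* j))))))))

    reciprocal-expr : reciprocal (k ℕ.+ (k ℕ.+ (k₃ ℕ.+ 1))) (coeffs (expr n m j)) ≐
      mulLins (rising base₁) (const 1ℚ) (const (fromℕ 2)) k
        (mulLins (rising base₂) (const (fromℕ 2)) (const 1ℚ) k
          (mulLins (rising base₃) (const (fromℤ (ℤ.- + 1))) (const 1ℚ) k₃ (dualLinearFactor j)))
    reciprocal-expr =
      ≐-trans (reciprocal-cong (k ℕ.+ (k ℕ.+ (k₃ ℕ.+ 1))) coeffs-expr)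
      (≐-trans (reciprocal-mulLins _ _ _ k (Deg≤-mulLins _ _ _ k (Deg≤-mulLins _ _ _ k₃ degree-linearFactor)))
      (mulLins-congʳ _ _ _ k
        (≐-trans (reciprocal-mulLins _ _ _ k (Deg≤-mulLins _ _ _ k₃ degree-linearFactor))
        (mulLins-congʳ _ _ _ k
          (≐-trans (reciprocal-mulLins _ _ _ k₃ degree-linearFactor)
          (mulLins-congʳ _ _ _ k₃ reciprocal-linearFactor))))))
      where
      degree-linearFactor : Deg≤ 1 linearFactor
      degree-linearFactor = Deg≤-mulLin 0ℚ (fromℤ (ℤ.- + 3)) (fromℤ (m ℤ.+ + (3 ℕ.* j))) Deg≤-one
      reciprocal-linearFactor : reciprocal 1 linearFactor ≐ dualLinearFactor j
      reciprocal-linearFactor =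
        ≐-trans (reciprocal-mulLin 0ℚ (fromℤ (ℤ.- + 3)) (fromℤ (m ℤ.+ + (3 ℕ.* j))) Deg≤-one)
                (mulLin-cong {b = fromℤ (ℤ.- + 3)} {c = 0ℚ}
                   (trans (fromℤ-+ m (+ (3 ℕ.* j))) (cong (λ x → fromℤ m + x) (fromℕ-* 3 j))) refl refl reciprocal-one)

    module _ (k₃+2+2j≡2n : k₃ ℕ.+ 2 ℕ.+ 2 ℕ.* j ≡ 2 ℕ.* n) where

      private
        fromℕ-2n : fromℕ (2 ℕ.* n) ≡ fromℕ k₃ + fromℕ 2 + fromℕ 2 * fromℕ j
        fromℕ-2n = begin
          fromℕ (2 ℕ.* n)                            ≡⟨ cong fromℕ k₃+2+2j≡2n ⟨
          fromℕ (k₃ ℕ.+ 2 ℕ.+ 2 ℕ.* j)               ≡⟨ fromℕ-+ (k₃ ℕ.+ 2) (2 ℕ.* j) ⟩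
          fromℕ (k₃ ℕ.+ 2) + fromℕ (2 ℕ.* j)         ≡⟨ cong₂ _+_ (fromℕ-+ k₃ 2) (fromℕ-* 2 j) ⟩
          fromℕ k₃ + fromℕ 2 + fromℕ 2 * fromℕ j     ∎
          where open ≡-Reasoning

        fromℕ-k : fromℕ k ≡ - 1ℚ + 1ℚ * fromℕ j
        fromℕ-k = trans (shift (fromℕ k)) (cong (λ x → - 1ℚ + 1ℚ * x) (sym (fromℕ-suc k)))
          where shift : ∀ x → x ≡ - 1ℚ + 1ℚ * (1ℚ + x)
                shift = solve-∀ ℚ-ring

        fromℕ-k₃ : fromℕ k₃ ≡ (fromℕ (2 ℕ.* n) - fromℕ 2) + - fromℕ 2 * fromℕ j
        fromℕ-k₃ = trans (cancel (fromℕ k₃) (fromℕ 2) (fromℕ j))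
                         (cong (λ x → x - fromℕ 2 + - fromℕ 2 * fromℕ j) (sym fromℕ-2n))
          where cancel : ∀ x t y → x ≡ x + t + t * y - t + - t * y
                cancel = solve-∀ ℚ-ring

        base₂-reversed : base₂ + fromℕ k - 1ℚ ≡ dualBase₂
        base₂-reversed = begin
          fromℤ (ℤ.- (+ j) ℤ.+ + 2) + fromℕ k - 1ℚ          ≡⟨ cong (λ x → x + fromℕ k - 1ℚ) (fromℤ-+ (ℤ.- (+ j)) (+ 2)) ⟩
          fromℤ (ℤ.- (+ j)) + fromℕ 2 + fromℕ k - 1ℚ         ≡⟨ cong (λ x → x + fromℕ 2 + fromℕ k - 1ℚ) (trans (fromℤ-neg (+ j)) (cong -_ (fromℕ-suc k))) ⟩
          - (1ℚ + fromℕ k) + fromℕ 2 + fromℕ k - 1ℚ          ≡⟨ cancel (fromℕ k) ⟩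
          0ℚ                                                 ∎
          where
          open ≡-Reasoning
          cancel : ∀ x → - (1ℚ + x) + (1ℚ + 1ℚ) + x - 1ℚ ≡ 0ℚ
          cancel = solve-∀ ℚ-ring

        base₃-reversed : base₃ + fromℕ k₃ - 1ℚ ≡ dualBase₃
        base₃-reversed = begin
          fromℤ (m ℤ.+ + (2 ℕ.* j) ℤ.+ + 2) + fromℕ k₃ - 1ℚ
            ≡⟨ cong (λ x → x + fromℕ k₃ - 1ℚ) (trans (fromℤ-+ (m ℤ.+ + (2 ℕ.* j)) (+ 2))
                                                     (cong (_+ fromℕ 2) (trans (fromℤ-+ m (+ (2 ℕ.* j))) (cong (λ x → fromℤ m + x) (fromℕ-* 2 j))))) ⟩
          fromℤ m + fromℕ 2 * fromℕ j + fromℕ 2 + fromℕ k₃ - 1ℚ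
            ≡⟨ regroup (fromℤ m) (fromℕ 2) (fromℕ j) (fromℕ k₃) ⟩
          fromℤ m + (fromℕ k₃ + fromℕ 2 + fromℕ 2 * fromℕ j) - 1ℚ
            ≡⟨ cong (λ x → fromℤ m + x - 1ℚ) fromℕ-2n ⟨
          fromℤ m + fromℕ (2 ℕ.* n) - 1ℚ
            ∎
          where
          open ≡-Reasoning
          regroup : ∀ a t y x → a + t * y + t + x - 1ℚ ≡ a + (x + t + t * y) - 1ℚ
          regroup = solve-∀ ℚ-ring

      swapped₁ : ∀ X → mulLins (rising base₁) (const 1ℚ) (const (fromℕ 2)) k X
                         ≐ scaleT (fromℕ (2 ℕ.^ k)) (mulT (dualFactor₁ j) X)
      swapped₁ X = ≐-trans (mulLins-rising-halved base₁ 1ℚ k X)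
        (scaleT-cong (fromℕ (2 ℕ.^ k)) (mulT-congˡ X (≐-sym (atAffine-agrees affineProd₁-poly (- 1ℚ) 1ℚ j k fromℕ-k))))

      swapped₂ : ∀ X → mulLins (rising base₂) (const (fromℕ 2)) (const 1ℚ) k X ≐ mulT (dualFactor₂ j) X
      swapped₂ X = ≐-trans (mulLins-rising-as-mulT base₂ dualBase₂ (fromℕ 2) k X base₂-reversed)
        (mulT-congˡ X (≐-sym (atAffine-agrees affineProd₂-poly (- 1ℚ) 1ℚ j k fromℕ-k)))

      swapped₃ : ∀ X → mulLins (rising base₃) (const (fromℤ (ℤ.- + 1))) (const 1ℚ) k₃ X ≐ mulT (dualFactor₃ j) X
      swapped₃ X = ≐-trans (mulLins-rising-as-mulT base₃ dualBase₃ (fromℤ (ℤ.- + 1)) k₃ X base₃-reversed)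
        (mulT-congˡ X (≐-sym (atAffine-agrees affineProd₃-poly (fromℕ (2 ℕ.* n) - fromℕ 2) (- fromℕ 2) j k₃ fromℕ-k₃)))

      dual-expr : reciprocal (k ℕ.+ (k ℕ.+ (k₃ ℕ.+ 1))) (coeffs (expr n m j)) ≐
        scaleT (fromℕ (2 ℕ.^ k)) (mulT (dualFactor₁ j) (mulT (dualFactor₂ j) (mulT (dualFactor₃ j) (dualLinearFactor j))))
      dual-expr =
        ≐-trans reciprocal-expr
        (≐-trans (mulLins-congʳ _ _ _ k (≐-trans (mulLins-congʳ _ _ _ k (swapped₃ (dualLinearFactor j)))
                                                (swapped₂ (mulT (dualFactor₃ j) (dualLinearFactor j)))))
                 (swapped₁ (mulT (dualFactor₂ j) (mulT (dualFactor₃ j) (dualLinearFactor j)))))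

      coeff2-expr : ∀ p q t → t ℕ.+ q ℕ.+ p ℕ.+ 3 ≡ 2 ℕ.* n →
        fromℤ (coeff2 (expr n m j) p q) ≡ fromℕ (2 ℕ.^ j) * dualProduct j t q
      coeff2-expr p q t t+q+p+3≡2n = begin
        coeffs (expr n m j) p q
          ≡⟨ reciprocal-coefficient (k ℕ.+ (k ℕ.+ (k₃ ℕ.+ 1))) (coeffs (expr n m j)) t p q total-degree ⟨
        reciprocal (k ℕ.+ (k ℕ.+ (k₃ ℕ.+ 1))) (coeffs (expr n m j)) t q
          ≡⟨ dual-expr t q ⟩
        fromℕ (2 ℕ.^ k) * M
          ≡⟨ cong (fromℕ (2 ℕ.^ k) *_) (double-half M) ⟨
        fromℕ (2 ℕ.^ k) * (fromℕ 2 * (½ * M))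
          ≡⟨ regroup (fromℕ (2 ℕ.^ k)) (fromℕ 2) (½ * M) ⟩
        fromℕ 2 * fromℕ (2 ℕ.^ k) * (½ * M)
          ≡⟨ cong (_* (½ * M)) (fromℕ-* 2 (2 ℕ.^ k)) ⟨
        fromℕ (2 ℕ.^ j) * dualProduct j t q
          ∎
        where
        open ≡-Reasoning
        M = mulT (dualFactor₁ j) (mulT (dualFactor₂ j) (mulT (dualFactor₃ j) (dualLinearFactor j))) t q
        regroup : ∀ a b c → a * (b * c) ≡ b * a * c
        regroup = solve-∀ ℚ-ring
        degrees : ∀ k k₃ → k ℕ.+ (k ℕ.+ (k₃ ℕ.+ 1)) ℕ.+ 3 ≡ k₃ ℕ.+ 2 ℕ.+ 2 ℕ.* suc k
        degrees = ℕ-Solver.solve-∀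
        total-degree : k ℕ.+ (k ℕ.+ (k₃ ℕ.+ 1)) ≡ t ℕ.+ q ℕ.+ p
        total-degree = ℕP.+-cancelʳ-≡ 3 _ _ (trans (degrees k k₃) (trans k₃+2+2j≡2n (sym t+q+p+3≡2n)))

2n∸2j∸2+2+2j≡2n : ∀ n j → j ℕ.+ 1 ℕ.≤ n → (2 ℕ.* n ℕ.∸ 2 ℕ.* j ℕ.∸ 2) ℕ.+ 2 ℕ.+ 2 ℕ.* j ≡ 2 ℕ.* n
2n∸2j∸2+2+2j≡2n n j j+1≤n = begin
  2 ℕ.* n ℕ.∸ 2 ℕ.* j ℕ.∸ 2 ℕ.+ 2 ℕ.+ 2 ℕ.* j      ≡⟨ cong (λ x → x ℕ.+ 2 ℕ.+ 2 ℕ.* j) (ℕP.∸-+-assoc (2 ℕ.* n) (2 ℕ.* j) 2) ⟩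
  2 ℕ.* n ℕ.∸ (2 ℕ.* j ℕ.+ 2) ℕ.+ 2 ℕ.+ 2 ℕ.* j    ≡⟨ regroup (2 ℕ.* n ℕ.∸ (2 ℕ.* j ℕ.+ 2)) j ⟩
  2 ℕ.* n ℕ.∸ (2 ℕ.* j ℕ.+ 2) ℕ.+ (2 ℕ.* j ℕ.+ 2)  ≡⟨ ℕP.m∸n+n≡m 2j+2≤2n ⟩
  2 ℕ.* n                                          ∎
  where
  open ≡-Reasoning
  regroup : ∀ x j → x ℕ.+ 2 ℕ.+ 2 ℕ.* j ≡ x ℕ.+ (2 ℕ.* j ℕ.+ 2)
  regroup = ℕ-Solver.solve-∀
  2j+2≤2n : 2 ℕ.* j ℕ.+ 2 ℕ.≤ 2 ℕ.* n
  2j+2≤2n = ℕP.≤-trans (ℕP.≤-reflexive (sym (ℕP.*-distribˡ-+ 2 j 1))) (ℕP.*-monoʳ-≤ 2 j+1≤n)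

N∸3∸p∸q+q+p+3≡N : ∀ N p q → p ℕ.+ q ℕ.+ 3 ℕ.≤ N → (N ℕ.∸ 3 ℕ.∸ p ℕ.∸ q) ℕ.+ q ℕ.+ p ℕ.+ 3 ≡ N
N∸3∸p∸q+q+p+3≡N N p q p+q+3≤N = begin
  N ℕ.∸ 3 ℕ.∸ p ℕ.∸ q ℕ.+ q ℕ.+ p ℕ.+ 3             ≡⟨ cong (λ x → x ℕ.+ q ℕ.+ p ℕ.+ 3) (ℕP.∸-+-assoc (N ℕ.∸ 3) p q) ⟩
  N ℕ.∸ 3 ℕ.∸ (p ℕ.+ q) ℕ.+ q ℕ.+ p ℕ.+ 3           ≡⟨ cong (λ x → x ℕ.+ q ℕ.+ p ℕ.+ 3) (ℕP.∸-+-assoc N 3 (p ℕ.+ q)) ⟩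
  N ℕ.∸ (3 ℕ.+ (p ℕ.+ q)) ℕ.+ q ℕ.+ p ℕ.+ 3         ≡⟨ cong (λ x → N ℕ.∸ x ℕ.+ q ℕ.+ p ℕ.+ 3) (ℕP.+-comm 3 (p ℕ.+ q)) ⟩
  N ℕ.∸ (p ℕ.+ q ℕ.+ 3) ℕ.+ q ℕ.+ p ℕ.+ 3           ≡⟨ regroup (N ℕ.∸ (p ℕ.+ q ℕ.+ 3)) p q ⟩
  N ℕ.∸ (p ℕ.+ q ℕ.+ 3) ℕ.+ (p ℕ.+ q ℕ.+ 3)         ≡⟨ ℕP.m∸n+n≡m p+q+3≤N ⟩
  N                                                 ∎
  where
  open ≡-Reasoning
  regroup : ∀ x p q → x ℕ.+ q ℕ.+ p ℕ.+ 3 ≡ x ℕ.+ (p ℕ.+ q ℕ.+ 3)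
  regroup = ℕ-Solver.solve-∀

lemmaA10 : (n : ℕ) (m : ℤ) (p q : ℕ) → p ℕ.+ 4 ℕ.≤ 2 ℕ.* n → q ℕ.+ 3 ℕ.≤ 2 ℕ.* n → p ℕ.+ q ℕ.+ 3 ℕ.≤ 2 ℕ.* n →
    ∃ λ (α : List ℚ) → length α ℕ.≤ 2 ℕ.* (2 ℕ.* n ℕ.∸ 3 ℕ.∸ p ℕ.∸ q) ℕ.+ q ×
      ((j : ℕ) → 1 ℕ.≤ j → j ℕ.+ 1 ℕ.≤ n →
        (coeff2 (expr n m j) p q) ℚ./ 1 ≡ ((+ (2 ℕ.^ j)) ℚ./ 1) ℚ.* evalℚ α ((+ j) ℚ./ 1))
lemmaA10 n m p q _ _ p+q+3≤2n = α , length-α , coefficient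
  where
  t = 2 ℕ.* n ℕ.∸ 3 ℕ.∸ p ℕ.∸ q
  α = proj₁ (coefficientPoly (PolyFamily-dualProduct n m) t q)
  length-α = proj₁ (proj₂ (coefficientPoly (PolyFamily-dualProduct n m) t q))
  coefficient : ∀ j → 1 ℕ.≤ j → j ℕ.+ 1 ℕ.≤ n → fromℤ (coeff2 (expr n m j) p q) ≡ fromℕ (2 ℕ.^ j) * evalℚ α (fromℕ j)
  coefficient (suc k) _ j+1≤n =
    trans (coeff2-expr n m k (2n∸2j∸2+2+2j≡2n n (suc k) j+1≤n) p q t (N∸3∸p∸q+q+p+3≡N (2 ℕ.* n) p q p+q+3≤2n))
          (cong (fromℕ (2 ℕ.^ suc k) *_) (proj₂ (proj₂ (coefficientPoly (PolyFamily-dualProduct n m) t q)) (suc k)))
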